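{- For integers $k\ge0$ and $i\ge 0$, let $f_{k,i}(x)=\sum_{e} x^{\mathrm{len}(e)-k-1}$, where the sum runs over all primitive ascent sequences $e$ (of any length $\ge1$) that avoid $\underline{12}0$, have $\mathrm{asc}(e)=k$, and have last entry equal to $i$. Then for all $0\leq i\leq k$, $$f_{k,i}(x)=(1+x)^{\binom{i}{2}}\prod_{\ell=i+1}^{k}\left((1+x)^{\ell}-1\right).$$
   Context: An inversion sequence of length $n$ is an integer sequence $e=e_1\ldots e_n$ with $0\le e_i<i$ for all $i$; $\mathrm{len}(e)=n$. $\mathrm{asc}(e_1\ldots e_i)=|\{\ell\in[i-1]:e_\ell<e_{\ell+1}\}|$. An ascent sequence is an inversion sequence $e$ with $e_{i+1}\le \mathrm{asc}(e_1\ldots e_i)+1$ for all $1\le i<n$; it is primitive if $e_i\neq e_{i+1}$ for all $i\in[n-1]$. A sequence $e$ avoids $\underline{12}0$ if there are no indices $2\le i<j\le n$ with $e_j<e_{i-1}<e_i$. -}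

module Defs where

open import Data.Nat using (ℕ; zero; suc; _+_; _*_; _∸_; _≤ᵇ_; _<ᵇ_; _≡ᵇ_)
open import Data.Nat.Combinatorics using (_C_)
open import Data.Bool using (Bool; true; false; _∧_; not; if_then_else_)
open import Data.List using (List; []; _∷_; _++_; [_]; map; concatMap; filter; length; upTo; take; applyUpTo)
open import Data.Bool.ListAction using (and; or)
open import Relation.Nullary.Decidable using ()
open import Data.Bool.Properties using ()
open import Relation.Unary using (Pred)

-- Sequences are lists of naturals e = e₁ … eₙ (positions are 1-based in
-- the paper; the helper 'at' below is 0-based: at e m = e_{m+1}).

at : List ℕ → ℕ → ℕ
at []      _       = 0
at (x ∷ _) zero    = x
at (_ ∷ r) (suc m) = at r m

lastE : List ℕ → ℕ
lastE []          = 0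
lastE (x ∷ [])    = x
lastE (_ ∷ y ∷ r) = lastE (y ∷ r)

invSeqs : ℕ → List (List ℕ)
invSeqs zero    = [] ∷ []
invSeqs (suc n) = concatMap (λ e → map (λ x → e ++ [ x ]) (upTo (suc n))) (invSeqs n)

asc : List ℕ → ℕ
asc (a ∷ b ∷ r) = (if a <ᵇ b then 1 else 0) + asc (b ∷ r)
asc _           = 0

-- ascent sequence condition: e_{i+1} ≤ asc(e₁…e_i) + 1 for all 1 ≤ i < n
isAscentSeq : List ℕ → Bool
isAscentSeq e = and (applyUpTo (λ m → at e (suc m) ≤ᵇ suc (asc (take (suc m) e))) (length e ∸ 1))

isPrimitive : List ℕ → Bool
isPrimitive (a ∷ b ∷ r) = not (a ≡ᵇ b) ∧ isPrimitive (b ∷ r)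
isPrimitive _           = true

-- avoids 12̲0: no indices 2 ≤ i < j ≤ n with e_j < e_{i-1} < e_i.
-- With 0-based p = i-2 (so e_{i-1} = at e p, e_i = at e (p+1)) and
-- 0-based q = j-1 ranging over p+2 … n-1.
avoids120 : List ℕ → Bool
avoids120 e = not (or (applyUpTo (λ p →
                 or (applyUpTo (λ t →
                   let q = p + 2 + t in
                   (at e q <ᵇ at e p) ∧ (at e p <ᵇ at e (suc p)))
                   (length e ∸ (p + 2))))
               (length e ∸ 1)))

counted : ℕ → ℕ → List ℕ → Bool
counted k i e = isAscentSeq e ∧ isPrimitive e ∧ avoids120 e ∧ (asc e ≡ᵇ k) ∧ (lastE e ≡ᵇ i)

-- number of counted sequences of length n (all ascent sequences are
-- inversion sequences, so enumerating inversion sequences suffices)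
count : ℕ → ℕ → ℕ → ℕ
count n k i = length (filter (λ e → counted k i e Data.Bool.≟ true) (invSeqs n))

-- Polynomials with ℕ coefficients as coefficient lists (constant first).

Poly : Set
Poly = List ℕ

_⊕_ : Poly → Poly → Poly
[]      ⊕ q       = q
p       ⊕ []      = p
(a ∷ p) ⊕ (b ∷ q) = (a + b) ∷ (p ⊕ q)

scale : ℕ → Poly → Poly
scale c = map (c *_)

_⊗_ : Poly → Poly → Poly
[]      ⊗ q = []
(a ∷ p) ⊗ q = scale a q ⊕ (0 ∷ (p ⊗ q))

one : Poly
one = 1 ∷ []

onePlusX : Poly
onePlusX = 1 ∷ 1 ∷ []

_^ₚ_ : Poly → ℕ → Poly
p ^ₚ zero  = one
p ^ₚ suc n = p ⊗ (p ^ₚ n)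

-- subtract the constant 1 (used only on (1+x)^ℓ whose constant term is 1)
minusOne : Poly → Poly
minusOne []      = []
minusOne (a ∷ p) = (a ∸ 1) ∷ p

coeff : Poly → ℕ → ℕ
coeff = at

-- ∏_{ℓ=a}^{a+m-1} ((1+x)^ℓ − 1)
prodFrom : ℕ → ℕ → Poly
prodFrom a zero    = one
prodFrom a (suc m) = minusOne (onePlusX ^ₚ a) ⊗ prodFrom (suc a) m

rhs : ℕ → ℕ → Poly
rhs k i = (onePlusX ^ₚ (i C 2)) ⊗ prodFrom (suc i) (k ∸ i)

-- A sequence counted by f_{k,i} of length n + 1 is one of length n with i appended.  What
-- decides whether i may be appended is the ascent bottom m of the sequence, the largest e_ℓ with
-- e_ℓ < e_{ℓ+1}: appending i creates 12̲0 exactly when i < m.  A final descent keeps asc and m,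
-- while a final ascent from l raises asc by one and makes l the new ascent bottom.  So the numbers
-- of sequences with given asc k, last entry i and ascent bottom m satisfy a recurrence in the
-- length, and their generating polynomials, with x^d marking length k + 1 + d, are
--   (1+x)^(k−i) f_{k−1,m}  for m < i ≤ k,   ((1+x)^(k−m) − 1) f_{k−1,m}  for i = m < k,
-- and 0 otherwise (for k ≥ 1).  This is checked by downward induction on i, inside an induction on
-- k that supplies f_{k−1,m}.  Summing over m ≤ i gives f_{k,i} by the telescoping identity
-- Σ_{m<i} f_{k,m} = (1+x)^C(i,2) ∏_{ℓ=i}^{k} ((1+x)^ℓ − 1).

module Submission where

open import Defs
open import Algebra.Bundles using (CommutativeMonoid; CommutativeSemiring)
open import Algebra.Structures using (IsCommutativeMonoid)
open import Algebra.Structures.Biased using (isCommutativeSemiringˡ)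
import Algebra.Properties.CommutativeSemigroup as CommSemigroupProperties
import Data.Bool
open import Data.Bool using (Bool; true; false; _∧_; _∨_; not; if_then_else_)
open import Data.Bool.Properties
  using (∧-zeroʳ; ∧-assoc; ∧-identityʳ; ∨-identityʳ; ∨-zeroʳ; ∨-assoc; ∨-commutativeMonoid; ∧-commutativeMonoid)
open import Data.Bool.ListAction using (and; or)
open import Data.Empty using (⊥-elim)
open import Data.List
  using ( List; []; _∷_; _++_; [_]; _∷ʳ_; map; length; take; filter; upTo; applyUpTo; concatMap
        ; InitLast; initLast; _∷ʳ′_)
open import Data.List.Properties using (applyUpTo-∷ʳ; upTo-∷ʳ)
open import Data.List.Relation.Unary.All as All using (All; []; _∷_)
open import Data.List.Relation.Unary.All.Properties using (concat⁺; map⁺; applyUpTo⁺₁; ∷ʳ⁺)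
open import Data.Nat
  using (ℕ; zero; suc; _+_; _*_; _∸_; _≤_; _<_; z≤n; s≤s; z<s; s<s; _≤ᵇ_; _<ᵇ_; _≡ᵇ_; _⊔_)
open import Data.Nat.Combinatorics using (_C_; nC1≡n; nCk+nC[k+1]≡[n+1]C[k+1])
open import Data.Nat.Properties
open import Data.Product using (_×_; _,_)
open import Data.Sum using (inj₁; inj₂)
open import Function using (id; _∘_)
open import Relation.Binary.Bundles using (Setoid)
open import Relation.Binary.Definitions using (tri<; tri≈; tri>)
open import Relation.Binary.PropositionalEquality hiding ([_])
import Relation.Binary.Reasoning.Setoid as SetoidReasoning
open import Relation.Binary.Structures using (IsEquivalence)
open import Relation.Nullary using (¬_; yes; no)
open import Relation.Nullary.Reflects using (Reflects; ofʸ; ofⁿ; fromEquivalence)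

reflects-true : ∀ {P : Set} {b} → Reflects P b → P → b ≡ true
reflects-true (ofʸ _)  _ = refl
reflects-true (ofⁿ ¬p) p = ⊥-elim (¬p p)

reflects-false : ∀ {P : Set} {b} → Reflects P b → ¬ P → b ≡ false
reflects-false (ofʸ p) ¬p = ⊥-elim (¬p p)
reflects-false (ofⁿ _) _  = refl

≡ᵇ-reflects-≡ : ∀ m n → Reflects (m ≡ n) (m ≡ᵇ n)
≡ᵇ-reflects-≡ m n = fromEquivalence (≡ᵇ⇒≡ m n) (≡⇒≡ᵇ m n)

module _ {m n : ℕ} where
  <ᵇ-true : m < n → (m <ᵇ n) ≡ true
  <ᵇ-true = reflects-true (<ᵇ-reflects-< m n)
  <ᵇ-false : ¬ m < n → (m <ᵇ n) ≡ false
  <ᵇ-false = reflects-false (<ᵇ-reflects-< m n)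
  ≤ᵇ-true : m ≤ n → (m ≤ᵇ n) ≡ true
  ≤ᵇ-true = reflects-true (≤ᵇ-reflects-≤ m n)
  ≤ᵇ-false : ¬ m ≤ n → (m ≤ᵇ n) ≡ false
  ≤ᵇ-false = reflects-false (≤ᵇ-reflects-≤ m n)
  ≡ᵇ-true : m ≡ n → (m ≡ᵇ n) ≡ true
  ≡ᵇ-true = reflects-true (≡ᵇ-reflects-≡ m n)
  ≡ᵇ-false : m ≢ n → (m ≡ᵇ n) ≡ false
  ≡ᵇ-false = reflects-false (≡ᵇ-reflects-≡ m n)

reflects-¬ : ∀ {P : Set} {b} → Reflects P b → b ≡ false → ¬ P
reflects-¬ (ofⁿ ¬p) _ = ¬p

∧-trueʳ : ∀ {a b} → a ∧ b ≡ true → b ≡ true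
∧-trueʳ {true} b≡true = b≡true

not-true : ∀ {b} → not b ≡ true → b ≡ false
not-true {false} _ = refl

sumBelow : ℕ → (ℕ → ℕ) → ℕ
sumBelow zero    f = 0
sumBelow (suc n) f = sumBelow n f + f n

sumBelow-cong : ∀ n {f g} → (∀ j → j < n → f j ≡ g j) → sumBelow n f ≡ sumBelow n g
sumBelow-cong zero    f≡g = refl
sumBelow-cong (suc n) f≡g = cong₂ _+_ (sumBelow-cong n (λ j j<n → f≡g j (m<n⇒m<1+n j<n))) (f≡g n ≤-refl)

sumBelow-zero : ∀ n {f} → (∀ j → j < n → f j ≡ 0) → sumBelow n f ≡ 0
sumBelow-zero zero    f≡0 = refl
sumBelow-zero (suc n) f≡0 = cong₂ _+_ (sumBelow-zero n (λ j j<n → f≡0 j (m<n⇒m<1+n j<n))) (f≡0 n ≤-refl)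

sumBelow-δ : ∀ n {f} x → x < n → (∀ j → j ≢ x → f j ≡ 0) → sumBelow n f ≡ f x
sumBelow-δ (suc n) {f} x x<1+n f≡0 with x ≟ n
... | yes refl = cong (_+ f x) (sumBelow-zero n (λ j j<x → f≡0 j (<⇒≢ j<x)))
... | no x≢n   = trans (cong₂ _+_ (sumBelow-δ n x (≤∧≢⇒< (≤-pred x<1+n) x≢n) f≡0) (f≡0 n (≢-sym x≢n)))
                       (+-identityʳ (f x))

open CommSemigroupProperties +-commutativeSemigroup using () renaming (interchange to +-interchange)

module _ {A : Set} where

  sumOver : List A → (A → ℕ) → ℕ
  sumOver []       f = 0
  sumOver (x ∷ xs) f = f x + sumOver xs f

  sumOver-++ : ∀ xs ys f → sumOver (xs ++ ys) f ≡ sumOver xs f + sumOver ys f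
  sumOver-++ []       ys f = refl
  sumOver-++ (x ∷ xs) ys f = trans (cong (f x +_) (sumOver-++ xs ys f)) (sym (+-assoc (f x) _ _))

  sumOver-cong : ∀ {P : A → Set} {xs f g} → All P xs → (∀ x → P x → f x ≡ g x) →
    sumOver xs f ≡ sumOver xs g
  sumOver-cong []         f≡g = refl
  sumOver-cong (px ∷ pxs) f≡g = cong₂ _+_ (f≡g _ px) (sumOver-cong pxs f≡g)

  sumOver-const0 : ∀ xs → sumOver xs (λ _ → 0) ≡ 0
  sumOver-const0 []       = refl
  sumOver-const0 (x ∷ xs) = sumOver-const0 xs

  sumOver-zero : ∀ {P : A → Set} {xs f} → All P xs → (∀ x → P x → f x ≡ 0) → sumOver xs f ≡ 0
  sumOver-zero {xs = xs} pxs f≡0 = trans (sumOver-cong pxs f≡0) (sumOver-const0 xs)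

  sumOver-+ : ∀ xs f g → sumOver xs (λ x → f x + g x) ≡ sumOver xs f + sumOver xs g
  sumOver-+ []       f g = refl
  sumOver-+ (x ∷ xs) f g = trans (cong (f x + g x +_) (sumOver-+ xs f g)) (+-interchange (f x) (g x) _ _)

  sumOver-if : ∀ xs c f → sumOver xs (λ x → if c then f x else 0) ≡ (if c then sumOver xs f else 0)
  sumOver-if xs true  f = refl
  sumOver-if xs false f = sumOver-const0 xs

  sumOver-sumBelow : ∀ xs n (F : ℕ → A → ℕ) →
    sumOver xs (λ x → sumBelow n (λ j → F j x)) ≡ sumBelow n (λ j → sumOver xs (F j))
  sumOver-sumBelow xs zero    F = sumOver-const0 xs
  sumOver-sumBelow xs (suc n) F =
    trans (sumOver-+ xs (λ x → sumBelow n (λ j → F j x)) (F n))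
          (cong (_+ sumOver xs (F n)) (sumOver-sumBelow xs n F))

sumOver-map : ∀ {A B : Set} (g : A → B) xs f → sumOver (map g xs) f ≡ sumOver xs (λ x → f (g x))
sumOver-map g []       f = refl
sumOver-map g (x ∷ xs) f = cong (f (g x) +_) (sumOver-map g xs f)

sumOver-concatMap : ∀ {A B : Set} (g : A → List B) xs f →
  sumOver (concatMap g xs) f ≡ sumOver xs (λ x → sumOver (g x) f)
sumOver-concatMap g []       f = refl
sumOver-concatMap g (x ∷ xs) f =
  trans (sumOver-++ (g x) (concatMap g xs) f) (cong (sumOver (g x) f +_) (sumOver-concatMap g xs f))

sumOver-upTo : ∀ n f → sumOver (upTo n) f ≡ sumBelow n f
sumOver-upTo zero    f = refl
sumOver-upTo (suc n) f = begin
  sumOver (upTo (suc n)) f              ≡⟨ cong (λ xs → sumOver xs f) (upTo-∷ʳ n) ⟨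
  sumOver (upTo n ++ [ n ]) f           ≡⟨ sumOver-++ (upTo n) [ n ] f ⟩
  sumOver (upTo n) f + (f n + 0)        ≡⟨ cong₂ _+_ (sumOver-upTo n f) (+-identityʳ (f n)) ⟩
  sumBelow n f + f n                    ∎
  where open ≡-Reasoning

sumAbove : ℕ → ℕ → (ℕ → ℕ) → ℕ
sumAbove n x f = sumBelow n (λ j → if x <ᵇ j then f j else 0)

sumAbove-suc : ∀ n x f → sumAbove n x f ≡ (if suc x <ᵇ n then f (suc x) else 0) + sumAbove n (suc x) f
sumAbove-suc zero    x f = refl
sumAbove-suc (suc n) x f rewrite sumAbove-suc n x f
  with x <ᵇ n | <ᵇ-reflects-< x n | suc x <ᵇ n | <ᵇ-reflects-< (suc x) n
... | false | _       | false | _      = refl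
... | false | ofⁿ x≮n | true  | ofʸ 1+x<n = ⊥-elim (x≮n (<-trans (n<1+n x) 1+x<n))
... | true  | ofʸ x<n | false | ofⁿ 1+x≮n with refl ← ≤-antisym x<n (≮⇒≥ 1+x≮n) =
  trans (+-comm (sumAbove (suc x) (suc x) f) _) (cong (f (suc x) +_) (sym (+-identityʳ _)))
... | true  | _       | true  | _      = +-assoc (f (suc x)) _ _

sumAbove-zero : ∀ n x f → (∀ j → x < j → f j ≡ 0) → sumAbove n x f ≡ 0
sumAbove-zero n x f f≡0 = sumBelow-zero n λ j _ → above j
  where
  above : ∀ j → (if x <ᵇ j then f j else 0) ≡ 0
  above j with x <ᵇ j | <ᵇ-reflects-< x j
  ... | true  | ofʸ x<j = f≡0 j x<j
  ... | false | _       = refl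

≡-downward : ∀ {f g : ℕ → ℕ} {lo hi} → f hi ≡ g hi →
  (∀ x → lo ≤ x → x < hi → f (suc x) ≡ g (suc x) → f x ≡ g x) →
  ∀ x → lo ≤ x → x ≤ hi → f x ≡ g x
≡-downward {f} {g} {lo} {hi} top step x lo≤x x≤hi = go (hi ∸ x) x (m+[n∸m]≡n x≤hi) lo≤x
  where
  go : ∀ t x → x + t ≡ hi → lo ≤ x → f x ≡ g x
  go zero    x x+0≡hi _    rewrite +-identityʳ x = subst (λ y → f y ≡ g y) (sym x+0≡hi) top
  go (suc t) x x+1+t≡hi lo≤x = step x lo≤x (subst (x <_) x+1+t≡hi (m<m+n x z<s))
    (go t (suc x) (trans (sym (+-suc x t)) x+1+t≡hi) (m≤n⇒m≤1+n lo≤x))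

-- Polynomials up to coefficientwise equality; 0 ∷ p is x · p

infix 4 _≈_
record _≈_ (p q : Poly) : Set where
  constructor coeffwise
  field coeff-≈ : ∀ d → coeff p d ≡ coeff q d
open _≈_

≈-isEquivalence : IsEquivalence _≈_
≈-isEquivalence = record
  { refl  = coeffwise λ _ → refl
  ; sym   = λ p≈q → coeffwise λ d → sym (coeff-≈ p≈q d)
  ; trans = λ p≈q q≈r → coeffwise λ d → trans (coeff-≈ p≈q d) (coeff-≈ q≈r d)
  }

≈-setoid : Setoid _ _
≈-setoid = record { isEquivalence = ≈-isEquivalence }

open IsEquivalence ≈-isEquivalence
  using () renaming (refl to ≈-refl; sym to ≈-sym; trans to ≈-trans; reflexive to ≈-reflexive)

coeff-⊕ : ∀ p q d → coeff (p ⊕ q) d ≡ coeff p d + coeff q d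
coeff-⊕ []      q       d       = refl
coeff-⊕ (a ∷ p) []      d       = sym (+-identityʳ _)
coeff-⊕ (a ∷ p) (b ∷ q) zero    = refl
coeff-⊕ (a ∷ p) (b ∷ q) (suc d) = coeff-⊕ p q d

coeff-scale : ∀ c p d → coeff (scale c p) d ≡ c * coeff p d
coeff-scale c []      d       = sym (*-zeroʳ c)
coeff-scale c (a ∷ p) zero    = refl
coeff-scale c (a ∷ p) (suc d) = coeff-scale c p d

∷-cong : ∀ {a p q} → p ≈ q → a ∷ p ≈ a ∷ q
∷-cong p≈q = coeffwise λ { zero → refl ; (suc d) → coeff-≈ p≈q d }

0∷[]≈[] : 0 ∷ [] ≈ []
0∷[]≈[] = coeffwise λ { zero → refl ; (suc d) → refl }

⊕-cong : ∀ {p p′ q q′} → p ≈ p′ → q ≈ q′ → p ⊕ q ≈ p′ ⊕ q′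
⊕-cong {p} {p′} {q} {q′} p≈p′ q≈q′ = coeffwise λ d → begin
  coeff (p ⊕ q) d           ≡⟨ coeff-⊕ p q d ⟩
  coeff p d + coeff q d     ≡⟨ cong₂ _+_ (coeff-≈ p≈p′ d) (coeff-≈ q≈q′ d) ⟩
  coeff p′ d + coeff q′ d   ≡⟨ coeff-⊕ p′ q′ d ⟨
  coeff (p′ ⊕ q′) d         ∎
  where open ≡-Reasoning

⊕-congˡ : ∀ p {q q′} → q ≈ q′ → p ⊕ q ≈ p ⊕ q′
⊕-congˡ p = ⊕-cong (≈-refl {p})

⊕-comm : ∀ p q → p ⊕ q ≈ q ⊕ p
⊕-comm p q = coeffwise λ d →
  trans (coeff-⊕ p q d) (trans (+-comm (coeff p d) _) (sym (coeff-⊕ q p d)))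

⊕-assoc : ∀ p q r → (p ⊕ q) ⊕ r ≈ p ⊕ (q ⊕ r)
⊕-assoc p q r = coeffwise λ d → begin
  coeff ((p ⊕ q) ⊕ r) d                   ≡⟨ coeff-⊕ (p ⊕ q) r d ⟩
  coeff (p ⊕ q) d + coeff r d             ≡⟨ cong (_+ coeff r d) (coeff-⊕ p q d) ⟩
  coeff p d + coeff q d + coeff r d       ≡⟨ +-assoc (coeff p d) _ _ ⟩
  coeff p d + (coeff q d + coeff r d)     ≡⟨ cong (coeff p d +_) (coeff-⊕ q r d) ⟨
  coeff p d + coeff (q ⊕ r) d             ≡⟨ coeff-⊕ p (q ⊕ r) d ⟨
  coeff (p ⊕ (q ⊕ r)) d                   ∎
  where open ≡-Reasoning

⊕-identityʳ : ∀ p → p ⊕ [] ≈ p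
⊕-identityʳ p = coeffwise λ d → trans (coeff-⊕ p [] d) (+-identityʳ _)

⊕-cancelʳ : ∀ {p q} r → p ⊕ r ≈ q ⊕ r → p ≈ q
⊕-cancelʳ {p} {q} r e = coeffwise λ d → +-cancelʳ-≡ (coeff r d) (coeff p d) (coeff q d)
  (trans (sym (coeff-⊕ p r d)) (trans (coeff-≈ e d) (coeff-⊕ q r d)))

⊕-isCommutativeMonoid : IsCommutativeMonoid _≈_ _⊕_ []
⊕-isCommutativeMonoid = record
  { isMonoid = record
    { isSemigroup = record
      { isMagma = record { isEquivalence = ≈-isEquivalence ; ∙-cong = ⊕-cong }
      ; assoc   = ⊕-assoc
      }
    ; identity = (λ _ → ≈-refl) , ⊕-identityʳ
    }
  ; comm = ⊕-comm
  }

⊕-commutativeMonoid : CommutativeMonoid _ _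
⊕-commutativeMonoid = record { isCommutativeMonoid = ⊕-isCommutativeMonoid }

open CommSemigroupProperties (CommutativeMonoid.commutativeSemigroup ⊕-commutativeMonoid)
  using () renaming (interchange to ⊕-interchange; x∙yz≈y∙xz to ⊕-left-comm)

scale-cong : ∀ c {p q} → p ≈ q → scale c p ≈ scale c q
scale-cong c {p} {q} p≈q = coeffwise λ d →
  trans (coeff-scale c p d) (trans (cong (c *_) (coeff-≈ p≈q d)) (sym (coeff-scale c q d)))

scale-distribʳ : ∀ a b p → scale (a + b) p ≈ scale a p ⊕ scale b p
scale-distribʳ a b p = coeffwise λ d → begin
  coeff (scale (a + b) p) d                  ≡⟨ coeff-scale (a + b) p d ⟩
  (a + b) * coeff p d                        ≡⟨ *-distribʳ-+ (coeff p d) a b ⟩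
  a * coeff p d + b * coeff p d              ≡⟨ cong₂ _+_ (coeff-scale a p d) (coeff-scale b p d) ⟨
  coeff (scale a p) d + coeff (scale b p) d  ≡⟨ coeff-⊕ (scale a p) (scale b p) d ⟨
  coeff (scale a p ⊕ scale b p) d            ∎
  where open ≡-Reasoning

scale-⊗ : ∀ c p q → scale c p ⊗ q ≈ scale c (p ⊗ q)
scale-⊗ c p q = coeffwise (go p)
  where
  open ≡-Reasoning
  go : ∀ p d → coeff (scale c p ⊗ q) d ≡ coeff (scale c (p ⊗ q)) d
  go []      d = refl
  go (b ∷ p) d = begin
    coeff (scale (c * b) q ⊕ (0 ∷ (scale c p ⊗ q))) d
      ≡⟨ coeff-⊕ (scale (c * b) q) _ d ⟩
    coeff (scale (c * b) q) d + coeff (0 ∷ (scale c p ⊗ q)) d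
      ≡⟨ cong₂ _+_ (coeff-scale (c * b) q d) (shifted d) ⟩
    c * b * coeff q d + c * coeff (0 ∷ (p ⊗ q)) d
      ≡⟨ cong (_+ c * coeff (0 ∷ (p ⊗ q)) d) (*-assoc c b _) ⟩
    c * (b * coeff q d) + c * coeff (0 ∷ (p ⊗ q)) d
      ≡⟨ *-distribˡ-+ c _ _ ⟨
    c * (b * coeff q d + coeff (0 ∷ (p ⊗ q)) d)
      ≡⟨ cong (λ z → c * (z + _)) (coeff-scale b q d) ⟨
    c * (coeff (scale b q) d + coeff (0 ∷ (p ⊗ q)) d)
      ≡⟨ cong (c *_) (coeff-⊕ (scale b q) _ d) ⟨
    c * coeff ((b ∷ p) ⊗ q) d
      ≡⟨ coeff-scale c ((b ∷ p) ⊗ q) d ⟨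
    coeff (scale c ((b ∷ p) ⊗ q)) d ∎
    where
    shifted : ∀ d → coeff (0 ∷ (scale c p ⊗ q)) d ≡ c * coeff (0 ∷ (p ⊗ q)) d
    shifted zero    = sym (*-zeroʳ c)
    shifted (suc d) = trans (go p d) (coeff-scale c (p ⊗ q) d)

scale-zero : ∀ p → scale 0 p ≈ []
scale-zero p = coeffwise (coeff-scale 0 p)

⊗-congˡ : ∀ p {q q′} → q ≈ q′ → p ⊗ q ≈ p ⊗ q′
⊗-congˡ []      q≈q′ = ≈-refl
⊗-congˡ (a ∷ p) q≈q′ = ⊕-cong (scale-cong a q≈q′) (∷-cong (⊗-congˡ p q≈q′))

⊗-zeroʳ : ∀ p → p ⊗ [] ≈ []
⊗-zeroʳ []      = ≈-refl
⊗-zeroʳ (a ∷ p) = ≈-trans (∷-cong (⊗-zeroʳ p)) 0∷[]≈[]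

0∷-⊗ : ∀ p q → (0 ∷ p) ⊗ q ≈ 0 ∷ (p ⊗ q)
0∷-⊗ p q = ⊕-cong (scale-zero q) (≈-refl {0 ∷ (p ⊗ q)})

⊗-∷ʳ : ∀ p a q → p ⊗ (a ∷ q) ≈ scale a p ⊕ (0 ∷ (p ⊗ q))
⊗-∷ʳ []      a q = ≈-sym 0∷[]≈[]
⊗-∷ʳ (b ∷ p) a q = coeffwise λ
  { zero    → cong (_+ 0) (*-comm b a)
  ; (suc d) → coeff-≈ tail d }
  where
  tail : scale b q ⊕ (p ⊗ (a ∷ q)) ≈ scale a p ⊕ (scale b q ⊕ (0 ∷ (p ⊗ q)))
  tail = ≈-trans (⊕-congˡ (scale b q) (⊗-∷ʳ p a q)) (⊕-left-comm (scale b q) (scale a p) _)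

⊗-comm : ∀ p q → p ⊗ q ≈ q ⊗ p
⊗-comm []      q = ≈-sym (⊗-zeroʳ q)
⊗-comm (a ∷ p) q = ≈-trans (⊕-congˡ (scale a q) (∷-cong (⊗-comm p q))) (≈-sym (⊗-∷ʳ q a p))

⊗-distribʳ : ∀ q p p′ → (p ⊕ p′) ⊗ q ≈ (p ⊗ q) ⊕ (p′ ⊗ q)
⊗-distribʳ q []      p′       = ≈-refl
⊗-distribʳ q (a ∷ p) []       = ≈-sym (⊕-identityʳ _)
⊗-distribʳ q (a ∷ p) (b ∷ p′) = ≈-trans
  (⊕-cong (scale-distribʳ a b q) (∷-cong (⊗-distribʳ q p p′)))
  (⊕-interchange (scale a q) (scale b q) (0 ∷ (p ⊗ q)) (0 ∷ (p′ ⊗ q)))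

⊗-assoc : ∀ p q r → (p ⊗ q) ⊗ r ≈ p ⊗ (q ⊗ r)
⊗-assoc []      q r = ≈-refl
⊗-assoc (a ∷ p) q r = ≈-trans (⊗-distribʳ r (scale a q) (0 ∷ (p ⊗ q)))
  (⊕-cong (scale-⊗ a q r) (≈-trans (0∷-⊗ (p ⊗ q) r) (∷-cong (⊗-assoc p q r))))

scale-identity : ∀ p → scale 1 p ≈ p
scale-identity p = coeffwise λ d → trans (coeff-scale 1 p d) (*-identityˡ _)

⊗-identityˡ : ∀ p → one ⊗ p ≈ p
⊗-identityˡ p = ≈-trans (⊕-cong (scale-identity p) 0∷[]≈[]) (⊕-identityʳ p)

⊗-congʳ : ∀ q {p p′} → p ≈ p′ → p ⊗ q ≈ p′ ⊗ q
⊗-congʳ q {p} {p′} p≈p′ = ≈-trans (⊗-comm p q) (≈-trans (⊗-congˡ q p≈p′) (⊗-comm q p′))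

⊗-distribˡ : ∀ p q q′ → p ⊗ (q ⊕ q′) ≈ (p ⊗ q) ⊕ (p ⊗ q′)
⊗-distribˡ p q q′ = ≈-trans (⊗-comm p (q ⊕ q′))
  (≈-trans (⊗-distribʳ p q q′) (⊕-cong (⊗-comm q p) (⊗-comm q′ p)))

⊗-isCommutativeMonoid : IsCommutativeMonoid _≈_ _⊗_ one
⊗-isCommutativeMonoid = record
  { isMonoid = record
    { isSemigroup = record
      { isMagma = record
        { isEquivalence = ≈-isEquivalence
        ; ∙-cong = λ {p} {_} {_} {q′} p≈p′ q≈q′ → ≈-trans (⊗-congˡ p q≈q′) (⊗-congʳ q′ p≈p′)
        }
      ; assoc   = ⊗-assoc
      }
    ; identity = ⊗-identityˡ , λ p → ≈-trans (⊗-comm p one) (⊗-identityˡ p)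
    }
  ; comm = ⊗-comm
  }

Poly-commutativeSemiring : CommutativeSemiring _ _
Poly-commutativeSemiring = record
  { isCommutativeSemiring = isCommutativeSemiringˡ record
    { +-isCommutativeMonoid = ⊕-isCommutativeMonoid
    ; *-isCommutativeMonoid = ⊗-isCommutativeMonoid
    ; distribʳ              = ⊗-distribʳ
    ; zeroˡ                 = λ _ → ≈-refl
    }
  }

open import Algebra.Solver.Ring.NaturalCoefficients.Default Poly-commutativeSemiring
  using (solve; _:+_; _:*_; _:=_; con)

infix 30 ⟨1+x⟩^_
⟨1+x⟩^_ : ℕ → Poly
⟨1+x⟩^ n = onePlusX ^ₚ n

^ₚ-+ : ∀ p a b → p ^ₚ (a + b) ≈ (p ^ₚ a) ⊗ (p ^ₚ b)
^ₚ-+ p zero    b = ≈-sym (⊗-identityˡ (p ^ₚ b))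
^ₚ-+ p (suc a) b = ≈-trans (⊗-congˡ p (^ₚ-+ p a b)) (≈-sym (⊗-assoc p (p ^ₚ a) (p ^ₚ b)))

onePlusX-⊗ : ∀ p → (onePlusX ⊗ p) ≈ (p ⊕ (0 ∷ p))
onePlusX-⊗ p = ⊕-cong (scale-identity p) (∷-cong (⊗-identityˡ p))

⟨1+x⟩^-suc-⊗ : ∀ s p → ((⟨1+x⟩^ suc s) ⊗ p) ≈ (((⟨1+x⟩^ s) ⊗ p) ⊕ (0 ∷ ((⟨1+x⟩^ s) ⊗ p)))
⟨1+x⟩^-suc-⊗ s p = ≈-trans (⊗-assoc onePlusX (⟨1+x⟩^ s) p) (onePlusX-⊗ ((⟨1+x⟩^ s) ⊗ p))

coeff₀-⟨1+x⟩^ : ∀ n → coeff (⟨1+x⟩^ n) 0 ≡ 1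
coeff₀-⟨1+x⟩^ zero    = refl
coeff₀-⟨1+x⟩^ (suc n) = begin
  coeff (onePlusX ⊗ ⟨1+x⟩^ n) 0               ≡⟨ coeff-≈ (onePlusX-⊗ (⟨1+x⟩^ n)) 0 ⟩
  coeff ((⟨1+x⟩^ n) ⊕ (0 ∷ ⟨1+x⟩^ n)) 0     ≡⟨ coeff-⊕ (⟨1+x⟩^ n) (0 ∷ ⟨1+x⟩^ n) 0 ⟩
  coeff (⟨1+x⟩^ n) 0 + 0                      ≡⟨ +-identityʳ _ ⟩
  coeff (⟨1+x⟩^ n) 0                          ≡⟨ coeff₀-⟨1+x⟩^ n ⟩
  1                                           ∎
  where open ≡-Reasoning

minusOne-⊕-one : ∀ p → 1 ≤ coeff p 0 → (minusOne p ⊕ one) ≈ p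
minusOne-⊕-one (a ∷ p) 1≤a = coeffwise λ
  { zero    → m∸n+n≡m 1≤a
  ; (suc d) → coeff-≈ (⊕-identityʳ p) d }

minusOne-⟨1+x⟩^-⊕-one : ∀ n → (minusOne (⟨1+x⟩^ n) ⊕ one) ≈ ⟨1+x⟩^ n
minusOne-⟨1+x⟩^-⊕-one n = minusOne-⊕-one (⟨1+x⟩^ n) (≤-reflexive (sym (coeff₀-⟨1+x⟩^ n)))

minusOne-⟨1+x⟩^-+ : ∀ i s →
  (((⟨1+x⟩^ s) ⊗ minusOne (⟨1+x⟩^ i)) ⊕ minusOne (⟨1+x⟩^ s)) ≈ minusOne (⟨1+x⟩^ (i + s))
minusOne-⟨1+x⟩^-+ i s = ⊕-cancelʳ one (begin
  ((Yₛ ⊗ Qᵢ) ⊕ Qₛ) ⊕ one         ≈⟨ ⊕-assoc (Yₛ ⊗ Qᵢ) Qₛ one ⟩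
  (Yₛ ⊗ Qᵢ) ⊕ (Qₛ ⊕ one)         ≈⟨ ⊕-congˡ (Yₛ ⊗ Qᵢ) (minusOne-⟨1+x⟩^-⊕-one s) ⟩
  (Yₛ ⊗ Qᵢ) ⊕ Yₛ                 ≈⟨ solve 2 (λ y q → y :* q :+ y := y :* (q :+ con 1)) ≈-refl Yₛ Qᵢ ⟩
  Yₛ ⊗ (Qᵢ ⊕ one)                ≈⟨ ⊗-congˡ Yₛ (minusOne-⟨1+x⟩^-⊕-one i) ⟩
  Yₛ ⊗ (⟨1+x⟩^ i)                ≈⟨ ^ₚ-+ onePlusX s i ⟨
  ⟨1+x⟩^ (s + i)                 ≡⟨ cong ⟨1+x⟩^_ (+-comm s i) ⟩
  ⟨1+x⟩^ (i + s)                 ≈⟨ minusOne-⟨1+x⟩^-⊕-one (i + s) ⟨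
  minusOne (⟨1+x⟩^ (i + s)) ⊕ one        ∎)
  where
  open SetoidReasoning ≈-setoid
  Yₛ Qₛ Qᵢ : Poly
  Yₛ = ⟨1+x⟩^ s
  Qₛ = minusOne (⟨1+x⟩^ s)
  Qᵢ = minusOne (⟨1+x⟩^ i)

prodFrom-∷ʳ : ∀ a m → prodFrom a (suc m) ≈ (prodFrom a m ⊗ minusOne (⟨1+x⟩^ (a + m)))
prodFrom-∷ʳ a zero    = begin
  minusOne (⟨1+x⟩^ a) ⊗ one       ≈⟨ ⊗-comm (minusOne (⟨1+x⟩^ a)) one ⟩
  one ⊗ minusOne (⟨1+x⟩^ a)       ≡⟨ cong (λ n → one ⊗ minusOne (⟨1+x⟩^ n)) (+-identityʳ a) ⟨
  one ⊗ minusOne (⟨1+x⟩^ (a + 0)) ∎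
  where open SetoidReasoning ≈-setoid
prodFrom-∷ʳ a (suc m) = begin
  Qₐ ⊗ prodFrom (suc a) (suc m)
    ≈⟨ ⊗-congˡ Qₐ (prodFrom-∷ʳ (suc a) m) ⟩
  Qₐ ⊗ (prodFrom (suc a) m ⊗ minusOne (⟨1+x⟩^ (suc a + m)))
    ≈⟨ ⊗-assoc Qₐ _ _ ⟨
  prodFrom a (suc m) ⊗ minusOne (⟨1+x⟩^ (suc a + m))
    ≡⟨ cong (λ n → prodFrom a (suc m) ⊗ minusOne (⟨1+x⟩^ n)) (+-suc a m) ⟨
  prodFrom a (suc m) ⊗ minusOne (⟨1+x⟩^ (a + suc m)) ∎
  where
  open SetoidReasoning ≈-setoid
  Qₐ : Poly
  Qₐ = minusOne (⟨1+x⟩^ a)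

suc[i]C2 : ∀ i → suc i C 2 ≡ i C 2 + i
suc[i]C2 i = begin
  suc i C 2        ≡⟨ nCk+nC[k+1]≡[n+1]C[k+1] i 1 ⟨
  i C 1 + i C 2    ≡⟨ cong (_+ i C 2) (nC1≡n i) ⟩
  i + i C 2        ≡⟨ +-comm i _ ⟩
  i C 2 + i        ∎
  where open ≡-Reasoning

polySum : (ℕ → Poly) → ℕ → Poly
polySum f zero    = []
polySum f (suc n) = polySum f n ⊕ f n

coeff-polySum : ∀ f n d → coeff (polySum f n) d ≡ sumBelow n (λ m → coeff (f m) d)
coeff-polySum f zero    d = refl
coeff-polySum f (suc n) d =
  trans (coeff-⊕ (polySum f n) (f n) d) (cong (_+ coeff (f n) d) (coeff-polySum f n d))

polySum-cong : ∀ {f g} n → (∀ m → m < n → f m ≈ g m) → polySum f n ≈ polySum g n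
polySum-cong zero    f≈g = ≈-refl
polySum-cong (suc n) f≈g = ⊕-cong (polySum-cong n (λ m m<n → f≈g m (m<n⇒m<1+n m<n))) (f≈g n ≤-refl)

polySum-⊗ : ∀ p f n → polySum (λ m → p ⊗ f m) n ≈ (p ⊗ polySum f n)
polySum-⊗ p f zero    = ≈-sym (⊗-zeroʳ p)
polySum-⊗ p f (suc n) = ≈-trans (⊕-cong (polySum-⊗ p f n) (≈-refl {p ⊗ f n}))
  (≈-sym (⊗-distribˡ p (polySum f n) (f n)))

polySum-vanishing : ∀ f {a n} → (∀ m → a ≤ m → f m ≈ []) → a ≤ n → polySum f n ≈ polySum f a
polySum-vanishing f {n = zero}  f≈0 z≤n = ≈-refl
polySum-vanishing f {n = suc n} f≈0 a≤1+n with m≤n⇒m<n∨m≡n a≤1+n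
... | inj₂ refl     = ≈-refl
... | inj₁ (s≤s a≤n) = ≈-trans (⊕-congˡ (polySum f n) (f≈0 n a≤n))
  (≈-trans (⊕-identityʳ (polySum f n)) (polySum-vanishing f f≈0 a≤n))

rhs-prefixSum : ∀ k i → i ≤ suc k → polySum (rhs k) i ≈ ((⟨1+x⟩^ (i C 2)) ⊗ prodFrom i (suc k ∸ i))
rhs-prefixSum k zero    _ = ≈-sym (≈-trans (⊗-identityˡ _) (≈-trans (0∷-⊗ [] (prodFrom 1 k)) 0∷[]≈[]))
rhs-prefixSum k (suc i) (s≤s i≤k) = begin
  polySum (rhs k) i ⊕ (A ⊗ B)
    ≈⟨ ⊕-cong (rhs-prefixSum k i (m≤n⇒m≤1+n i≤k)) (≈-refl {A ⊗ B}) ⟩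
  (A ⊗ prodFrom i (suc k ∸ i)) ⊕ (A ⊗ B)
    ≡⟨ cong (λ n → (A ⊗ prodFrom i n) ⊕ (A ⊗ B)) (+-∸-assoc 1 i≤k) ⟩
  (A ⊗ (Qᵢ ⊗ B)) ⊕ (A ⊗ B)
    ≈⟨ solve 3 (λ a b q → a :* (q :* b) :+ a :* b := a :* ((q :+ con 1) :* b)) ≈-refl A B Qᵢ ⟩
  A ⊗ ((Qᵢ ⊕ one) ⊗ B)
    ≈⟨ ⊗-congˡ A (⊗-congʳ B (minusOne-⟨1+x⟩^-⊕-one i)) ⟩
  A ⊗ ((⟨1+x⟩^ i) ⊗ B)
    ≈⟨ ⊗-assoc A (⟨1+x⟩^ i) B ⟨
  (A ⊗ (⟨1+x⟩^ i)) ⊗ B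
    ≈⟨ ⊗-congʳ B (^ₚ-+ onePlusX (i C 2) i) ⟨
  (⟨1+x⟩^ (i C 2 + i)) ⊗ B
    ≡⟨ cong (λ n → (⟨1+x⟩^ n) ⊗ B) (suc[i]C2 i) ⟨
  (⟨1+x⟩^ (suc i C 2)) ⊗ B ∎
  where
  open SetoidReasoning ≈-setoid
  A B Qᵢ : Poly
  A = ⟨1+x⟩^ (i C 2)
  B = prodFrom (suc i) (k ∸ i)
  Qᵢ = minusOne (⟨1+x⟩^ i)

-- Appending an entry to a sequence

ascentBottom : List ℕ → ℕ
ascentBottom (a ∷ b ∷ r) = (if a <ᵇ b then a else 0) ⊔ ascentBottom (b ∷ r)
ascentBottom _           = 0

length-∷ʳ : ∀ (e : List ℕ) y → length (e ∷ʳ y) ≡ suc (length e)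
length-∷ʳ []      y = refl
length-∷ʳ (x ∷ e) y = cong suc (length-∷ʳ e y)

at-++ˡ : ∀ (e ys : List ℕ) {q} → q < length e → at (e ++ ys) q ≡ at e q
at-++ˡ (x ∷ e) ys {zero}  _         = refl
at-++ˡ (x ∷ e) ys {suc q} (s≤s q<n) = at-++ˡ e ys q<n

at-length : ∀ (e : List ℕ) y ys → at (e ++ y ∷ ys) (length e) ≡ y
at-length []      y ys = refl
at-length (x ∷ e) y ys = at-length e y ys

take-++ˡ : ∀ (e ys : List ℕ) {m} → m ≤ length e → take m (e ++ ys) ≡ take m e
take-++ˡ e       ys {zero}  _         = refl
take-++ˡ (x ∷ e) ys {suc m} (s≤s m≤n) = cong (x ∷_) (take-++ˡ e ys m≤n)

take-length-++ : ∀ (e ys : List ℕ) → take (length e) (e ++ ys) ≡ e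
take-length-++ []      ys = refl
take-length-++ (x ∷ e) ys = cong (x ∷_) (take-length-++ e ys)

lastE-∷ʳ : ∀ e y → lastE (e ∷ʳ y) ≡ y
lastE-∷ʳ []          y = refl
lastE-∷ʳ (a ∷ [])    y = refl
lastE-∷ʳ (a ∷ b ∷ r) y = lastE-∷ʳ (b ∷ r) y

asc-∷ʳ : ∀ a r y → asc ((a ∷ r) ∷ʳ y) ≡ (if lastE (a ∷ r) <ᵇ y then suc (asc (a ∷ r)) else asc (a ∷ r))
asc-∷ʳ a []      y with a <ᵇ y
... | true  = refl
... | false = refl
asc-∷ʳ a (b ∷ r) y rewrite asc-∷ʳ b r y with lastE (b ∷ r) <ᵇ y
... | true  = +-suc (if a <ᵇ b then 1 else 0) (asc (b ∷ r))
... | false = refl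

ascentBottom-∷ʳ : ∀ a r y → ascentBottom ((a ∷ r) ∷ʳ y)
  ≡ (if lastE (a ∷ r) <ᵇ y then ascentBottom (a ∷ r) ⊔ lastE (a ∷ r) else ascentBottom (a ∷ r))
ascentBottom-∷ʳ a []      y with a <ᵇ y
... | true  = ⊔-identityʳ a
... | false = refl
ascentBottom-∷ʳ a (b ∷ r) y rewrite ascentBottom-∷ʳ b r y with lastE (b ∷ r) <ᵇ y
... | true  = sym (⊔-assoc (if a <ᵇ b then a else 0) (ascentBottom (b ∷ r)) _)
... | false = refl

isPrimitive-∷ʳ : ∀ a r y → isPrimitive ((a ∷ r) ∷ʳ y) ≡ isPrimitive (a ∷ r) ∧ not (lastE (a ∷ r) ≡ᵇ y)
isPrimitive-∷ʳ a []      y = ∧-identityʳ _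
isPrimitive-∷ʳ a (b ∷ r) y rewrite isPrimitive-∷ʳ b r y =
  sym (∧-assoc (not (a ≡ᵇ b)) (isPrimitive (b ∷ r)) _)

applyUpTo-cong : ∀ {A : Set} {f g : ℕ → A} n → (∀ m → m < n → f m ≡ g m) → applyUpTo f n ≡ applyUpTo g n
applyUpTo-cong zero    f≡g = refl
applyUpTo-cong (suc n) f≡g = cong₂ _∷_ (f≡g 0 z<s) (applyUpTo-cong n (λ m m<n → f≡g (suc m) (s<s m<n)))

and-∷ʳ : ∀ bs b → and (bs ∷ʳ b) ≡ and bs ∧ b
and-∷ʳ []       b = ∧-identityʳ b
and-∷ʳ (b′ ∷ bs) b rewrite and-∷ʳ bs b = sym (∧-assoc b′ (and bs) b)

or-∷ʳ : ∀ bs b → or (bs ∷ʳ b) ≡ or bs ∨ b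
or-∷ʳ []        b = ∨-identityʳ b
or-∷ʳ (b′ ∷ bs) b rewrite or-∷ʳ bs b = sym (∨-assoc b′ (or bs) b)

open CommSemigroupProperties (CommutativeMonoid.commutativeSemigroup ∨-commutativeMonoid)
  using () renaming (interchange to ∨-interchange)

isAscentSeq-∷ʳ : ∀ a r y → isAscentSeq ((a ∷ r) ∷ʳ y) ≡ isAscentSeq (a ∷ r) ∧ (y ≤ᵇ suc (asc (a ∷ r)))
isAscentSeq-∷ʳ a r y = begin
  and (applyUpTo (bounded f) (length (r ∷ʳ y)))
    ≡⟨ cong (λ n → and (applyUpTo (bounded f) n)) (length-∷ʳ r y) ⟩
  and (applyUpTo (bounded f) (suc (length r)))
    ≡⟨ cong and (applyUpTo-∷ʳ (bounded f) (length r)) ⟨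
  and (applyUpTo (bounded f) (length r) ∷ʳ bounded f (length r))
    ≡⟨ and-∷ʳ (applyUpTo (bounded f) (length r)) _ ⟩
  and (applyUpTo (bounded f) (length r)) ∧ bounded f (length r)
    ≡⟨ cong₂ _∧_ (cong and (applyUpTo-cong (length r) earlier)) last ⟩
  and (applyUpTo (bounded e) (length r)) ∧ (y ≤ᵇ suc (asc e)) ∎
  where
  open ≡-Reasoning
  e f : List ℕ
  e = a ∷ r
  f = e ∷ʳ y
  bounded : List ℕ → ℕ → Bool
  bounded s m = at s (suc m) ≤ᵇ suc (asc (take (suc m) s))
  earlier : ∀ m → m < length r → bounded f m ≡ bounded e m
  earlier m m<n =
    cong₂ (λ u v → u ≤ᵇ suc (asc v)) (at-++ˡ e [ y ] (s≤s m<n)) (take-++ˡ e [ y ] (s≤s (<⇒≤ m<n)))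
  last : bounded f (length r) ≡ (y ≤ᵇ suc (asc e))
  last = cong₂ (λ u v → u ≤ᵇ suc (asc v)) (at-length e y []) (take-length-++ e [ y ])

-- an occurrence of 12̲0 at positions p, p+1 and p+2+t (0-based)
occurs120At : List ℕ → ℕ → ℕ → Bool
occurs120At e p t = (at e (p + 2 + t) <ᵇ at e p) ∧ (at e p <ᵇ at e (suc p))

occurs120From : List ℕ → ℕ → Bool
occurs120From e p = or (applyUpTo (occurs120At e p) (length e ∸ (p + 2)))

completes120At : List ℕ → ℕ → ℕ → Bool
completes120At e y p = (y <ᵇ at e p) ∧ (at e p <ᵇ at e (suc p))

completes120 : List ℕ → ℕ → Bool
completes120 e y = or (applyUpTo (completes120At e y) (length e ∸ 1))

occurs120From-∷ʳ : ∀ a r y p → p < length r →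
  occurs120From ((a ∷ r) ∷ʳ y) p ≡ occurs120From (a ∷ r) p ∨ completes120At (a ∷ r) y p
occurs120From-∷ʳ a r y p p<n = begin
  or (applyUpTo (occurs120At f p) (length f ∸ (p + 2)))
    ≡⟨ cong (λ n → or (applyUpTo (occurs120At f p) n)) length≡ ⟩
  or (applyUpTo (occurs120At f p) (suc D))
    ≡⟨ cong or (applyUpTo-∷ʳ (occurs120At f p) D) ⟨
  or (applyUpTo (occurs120At f p) D ∷ʳ occurs120At f p D)
    ≡⟨ or-∷ʳ (applyUpTo (occurs120At f p) D) _ ⟩
  or (applyUpTo (occurs120At f p) D) ∨ occurs120At f p D
    ≡⟨ cong₂ _∨_ (cong or (applyUpTo-cong D earlier)) last ⟩
  occurs120From e p ∨ completes120At e y p ∎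
  where
  open ≡-Reasoning
  e f : List ℕ
  e = a ∷ r
  f = e ∷ʳ y
  D : ℕ
  D = length e ∸ (p + 2)
  p+2≤n : p + 2 ≤ length e
  p+2≤n = subst (_≤ length e) (+-comm 2 p) (s≤s p<n)
  length≡ : length f ∸ (p + 2) ≡ suc D
  length≡ = trans (cong (_∸ (p + 2)) (length-∷ʳ e y)) (+-∸-assoc 1 p+2≤n)
  atₚ : at f p ≡ at e p
  atₚ = at-++ˡ e [ y ] (<-trans p<n (n<1+n _))
  atₚ₊₁ : at f (suc p) ≡ at e (suc p)
  atₚ₊₁ = at-++ˡ e [ y ] (s≤s p<n)
  ordered-cong : ∀ {u u′ v v′ w w′} → u ≡ u′ → v ≡ v′ → w ≡ w′ →
    ((u <ᵇ v) ∧ (v <ᵇ w)) ≡ ((u′ <ᵇ v′) ∧ (v′ <ᵇ w′))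
  ordered-cong refl refl refl = refl
  earlier : ∀ t → t < D → occurs120At f p t ≡ occurs120At e p t
  earlier t t<D = ordered-cong
    (at-++ˡ e [ y ] (subst (p + 2 + t <_) (m+[n∸m]≡n p+2≤n) (+-monoʳ-< (p + 2) t<D))) atₚ atₚ₊₁
  last : occurs120At f p D ≡ completes120At e y p
  last = ordered-cong (trans (cong (at f) (m+[n∸m]≡n p+2≤n)) (at-length e y [])) atₚ atₚ₊₁

or-applyUpTo-∨ : ∀ (f g : ℕ → Bool) n →
  or (applyUpTo (λ p → f p ∨ g p) n) ≡ or (applyUpTo f n) ∨ or (applyUpTo g n)
or-applyUpTo-∨ f g zero    = refl
or-applyUpTo-∨ f g (suc n) =
  trans (cong ((f 0 ∨ g 0) ∨_) (or-applyUpTo-∨ (f ∘ suc) (g ∘ suc) n)) (∨-interchange (f 0) (g 0) _ _)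

not-∨ : ∀ a b → not (a ∨ b) ≡ not a ∧ not b
not-∨ true  b = refl
not-∨ false b = refl

avoids120-∷ʳ : ∀ a r y → avoids120 ((a ∷ r) ∷ʳ y) ≡ avoids120 (a ∷ r) ∧ not (completes120 (a ∷ r) y)
avoids120-∷ʳ a r y = begin
  not (or (applyUpTo (occurs120From f) (length (r ∷ʳ y))))
    ≡⟨ cong (λ n → not (or (applyUpTo (occurs120From f) n))) (length-∷ʳ r y) ⟩
  not (or (applyUpTo (occurs120From f) (suc L)))
    ≡⟨ cong (not ∘ or) (applyUpTo-∷ʳ (occurs120From f) L) ⟨
  not (or (applyUpTo (occurs120From f) L ∷ʳ occurs120From f L))
    ≡⟨ cong not (or-∷ʳ (applyUpTo (occurs120From f) L) _) ⟩
  not (or (applyUpTo (occurs120From f) L) ∨ occurs120From f L)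
    ≡⟨ cong (λ b → not (or (applyUpTo (occurs120From f) L) ∨ b)) none-last ⟩
  not (or (applyUpTo (occurs120From f) L) ∨ false)
    ≡⟨ cong not (∨-identityʳ _) ⟩
  not (or (applyUpTo (occurs120From f) L))
    ≡⟨ cong (not ∘ or) (applyUpTo-cong L (occurs120From-∷ʳ a r y)) ⟩
  not (or (applyUpTo (λ p → occurs120From e p ∨ completes120At e y p) L))
    ≡⟨ cong not (or-applyUpTo-∨ (occurs120From e) (completes120At e y) L) ⟩
  not (or (applyUpTo (occurs120From e) L) ∨ completes120 e y)
    ≡⟨ not-∨ (or (applyUpTo (occurs120From e) L)) (completes120 e y) ⟩
  avoids120 e ∧ not (completes120 e y) ∎
  where
  open ≡-Reasoning
  e f : List ℕ
  e = a ∷ r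
  f = e ∷ʳ y
  L : ℕ
  L = length r
  none-last : occurs120From f L ≡ false
  none-last = cong (λ n → or (applyUpTo (occurs120At f L) n))
    (m≤n⇒m∸n≡0 (≤-reflexive (trans (cong suc (length-∷ʳ r y)) (+-comm 2 L))))

<ᵇ-⊔ : ∀ y u v → (y <ᵇ (u ⊔ v)) ≡ (y <ᵇ u) ∨ (y <ᵇ v)
<ᵇ-⊔ y u v with ≤-total u v
... | inj₁ u≤v rewrite m≤n⇒m⊔n≡n u≤v with y <ᵇ u | <ᵇ-reflects-< y u
...   | true  | ofʸ y<u = <ᵇ-true (<-≤-trans y<u u≤v)
...   | false | ofⁿ _   = refl
<ᵇ-⊔ y u v | inj₂ v≤u rewrite m≥n⇒m⊔n≡m v≤u with y <ᵇ v | <ᵇ-reflects-< y v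
...   | true  | ofʸ y<v = trans (<ᵇ-true (<-≤-trans y<v v≤u)) (sym (∨-zeroʳ _))
...   | false | ofⁿ _   = sym (∨-identityʳ _)

completes120≡<ᵇascentBottom : ∀ e y → completes120 e y ≡ (y <ᵇ ascentBottom e)
completes120≡<ᵇascentBottom []          y = refl
completes120≡<ᵇascentBottom (a ∷ [])    y = refl
completes120≡<ᵇascentBottom (a ∷ b ∷ r) y
  rewrite completes120≡<ᵇascentBottom (b ∷ r) y | <ᵇ-⊔ y (if a <ᵇ b then a else 0) (ascentBottom (b ∷ r))
  with a <ᵇ b
... | true  = cong (_∨ (y <ᵇ ascentBottom (b ∷ r))) (∧-identityʳ _)
... | false = cong (_∨ (y <ᵇ ascentBottom (b ∷ r))) (trans (∧-zeroʳ _) (sym (<ᵇ-false {y} {0} λ ())))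

open CommSemigroupProperties (CommutativeMonoid.commutativeSemigroup ∧-commutativeMonoid)
  using () renaming (interchange to ∧-interchange)

valid : List ℕ → Bool
valid e = isAscentSeq e ∧ (isPrimitive e ∧ avoids120 e)

valid⇒avoids120 : ∀ {e} → valid e ≡ true → avoids120 e ≡ true
valid⇒avoids120 {e} valid≡true = ∧-trueʳ {isPrimitive e} (∧-trueʳ {isAscentSeq e} valid≡true)

counted≡valid∧ : ∀ k i e → counted k i e ≡ valid e ∧ ((asc e ≡ᵇ k) ∧ (lastE e ≡ᵇ i))
counted≡valid∧ k i e = trans (cong (isAscentSeq e ∧_) (sym (∧-assoc (isPrimitive e) (avoids120 e) _)))
  (sym (∧-assoc (isAscentSeq e) _ _))

-- y can be appended to a valid sequence with asc A, last entry l and ascent bottom b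
appendable : ℕ → ℕ → ℕ → ℕ → Bool
appendable A l b y = (y ≤ᵇ suc A) ∧ (not (l ≡ᵇ y) ∧ not (y <ᵇ b))

valid-∷ʳ : ∀ a r y → valid ((a ∷ r) ∷ʳ y)
  ≡ valid (a ∷ r) ∧ appendable (asc (a ∷ r)) (lastE (a ∷ r)) (ascentBottom (a ∷ r)) y
valid-∷ʳ a r y
  rewrite isAscentSeq-∷ʳ a r y | isPrimitive-∷ʳ a r y | avoids120-∷ʳ a r y
        | completes120≡<ᵇascentBottom (a ∷ r) y
  = trans (cong ((P ∧ s₁) ∧_) (∧-interchange Q s₂ R s₃)) (∧-interchange P s₁ (Q ∧ R) (s₂ ∧ s₃))
  where
  e : List ℕ
  e = a ∷ r
  P Q R s₁ s₂ s₃ : Bool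
  P = isAscentSeq e
  Q = isPrimitive e
  R = avoids120 e
  s₁ = y ≤ᵇ suc (asc e)
  s₂ = not (lastE e ≡ᵇ y)
  s₃ = not (y <ᵇ ascentBottom e)

ascentBottom≤lastE : ∀ {e} → avoids120 e ≡ true → ascentBottom e ≤ lastE e
ascentBottom≤lastE {e} = go (initLast e)
  where
  go : ∀ {e} → InitLast e → avoids120 e ≡ true → ascentBottom e ≤ lastE e
  go []               _ = z≤n
  go ([] ∷ʳ′ y)       _ = z≤n
  go ((a ∷ r) ∷ʳ′ y) avoids
    rewrite ascentBottom-∷ʳ a r y | lastE-∷ʳ (a ∷ r) y | avoids120-∷ʳ a r y
          | completes120≡<ᵇascentBottom (a ∷ r) y
    with lastE (a ∷ r) <ᵇ y | <ᵇ-reflects-< (lastE (a ∷ r)) y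
  ... | true  | ofʸ l<y = ⊔-lub (≮⇒≥ y≮b) (<⇒≤ l<y)
    where y≮b = reflects-¬ (<ᵇ-reflects-< _ _) (not-true (∧-trueʳ avoids))
  ... | false | ofⁿ _   = ≮⇒≥ (reflects-¬ (<ᵇ-reflects-< _ _) (not-true (∧-trueʳ avoids)))

-- Counting sequences by their last step

𝟙 : Bool → ℕ
𝟙 true  = 1
𝟙 false = 0

if-same : ∀ b (n : ℕ) → (if b then n else n) ≡ n
if-same true  n = refl
if-same false n = refl

𝟙-∧-false : ∀ b → 𝟙 (b ∧ false) ≡ 0
𝟙-∧-false b rewrite ∧-zeroʳ b = refl

hasType : ℕ → ℕ → ℕ → List ℕ → Bool
hasType k i m e = valid e ∧ ((asc e ≡ᵇ k) ∧ ((lastE e ≡ᵇ i) ∧ (ascentBottom e ≡ᵇ m)))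

hasType-lastE≢ : ∀ k i m e → lastE e ≢ i → hasType k i m e ≡ false
hasType-lastE≢ k i m e last≢i rewrite ≡ᵇ-false last≢i | ∧-zeroʳ (asc e ≡ᵇ k) = ∧-zeroʳ (valid e)

hasType-asc≢ : ∀ k i m e → asc e ≢ k → hasType k i m e ≡ false
hasType-asc≢ k i m e asc≢k rewrite ≡ᵇ-false asc≢k = ∧-zeroʳ (valid e)

hasType-ascentBottom≢ : ∀ k i m e → ascentBottom e ≢ m → hasType k i m e ≡ false
hasType-ascentBottom≢ k i m e bottom≢m
  rewrite ≡ᵇ-false bottom≢m | ∧-zeroʳ (lastE e ≡ᵇ i) | ∧-zeroʳ (asc e ≡ᵇ k) = ∧-zeroʳ (valid e)

hasType-ascentBottom : ∀ k i e → hasType k i (ascentBottom e) e ≡ counted k i e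
hasType-ascentBottom k i e rewrite ≡ᵇ-true {ascentBottom e} refl | ∧-identityʳ (lastE e ≡ᵇ i) =
  sym (counted≡valid∧ k i e)

counted-asc≢ : ∀ k i e → asc e ≢ k → counted k i e ≡ false
counted-asc≢ k i e asc≢k rewrite counted≡valid∧ k i e | ≡ᵇ-false asc≢k = ∧-zeroʳ (valid e)

ascentTerm : ℕ → ℕ → ℕ → List ℕ → ℕ
ascentTerm zero    i m e = 0
ascentTerm (suc k) i m e = if (m <ᵇ i) ∧ (i ≤ᵇ suc k) then 𝟙 (counted k m e) else 0

descentTerm : ℕ → ℕ → ℕ → ℕ → List ℕ → ℕ
descentTerm n k i m e =
  if (m ≤ᵇ i) ∧ (i ≤ᵇ suc k) then sumAbove n i (λ j → 𝟙 (hasType k j m e)) else 0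

ascentPart : ℕ → ℕ → ℕ → Bool → ℕ → ℕ → ℕ
ascentPart zero    i m v A l = 0
ascentPart (suc k) i m v A l = if (m <ᵇ i) ∧ (i ≤ᵇ suc k) then 𝟙 (v ∧ ((A ≡ᵇ k) ∧ (l ≡ᵇ m))) else 0

ascentPart-false : ∀ k i m A l → ascentPart k i m false A l ≡ 0
ascentPart-false zero    i m A l = refl
ascentPart-false (suc k) i m A l = if-same _ 0

ascentPart-≤ : ∀ k {i m} A {l} → i ≤ l → ascentPart k i m true A l ≡ 0
ascentPart-≤ zero    A i≤l = refl
ascentPart-≤ (suc k) {i} {m} A {l} i≤l with m <ᵇ i | <ᵇ-reflects-< m i
... | false | _       = refl
... | true  | ofʸ m<i rewrite ≡ᵇ-false {l} {m} (≢-sym (<⇒≢ (<-≤-trans m<i i≤l))) | ∧-zeroʳ (A ≡ᵇ k) =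
  if-same _ 0

𝟙-ascent : ∀ k {i m} A {l} → l < i →
  𝟙 ((i ≤ᵇ suc A) ∧ ((suc A ≡ᵇ k) ∧ (l ≡ᵇ m))) ≡ ascentPart k i m true A l
𝟙-ascent zero    {i}     A l<i = 𝟙-∧-false (i ≤ᵇ suc A)
𝟙-ascent (suc k) {i} {m} A {l} l<i with A ≟ k | l ≟ m
... | yes refl | yes refl rewrite ≡ᵇ-true {A} refl | ≡ᵇ-true {l} refl | <ᵇ-true l<i with i ≤ᵇ suc A
...   | true  = refl
...   | false = refl
𝟙-ascent (suc k) {i} A l<i | yes refl | no l≢m rewrite ≡ᵇ-true {A} refl | ≡ᵇ-false l≢m =
  trans (𝟙-∧-false (i ≤ᵇ suc A)) (sym (if-same _ 0))
𝟙-ascent (suc k) {i} A l<i | no A≢k | _ rewrite ≡ᵇ-false A≢k =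
  trans (𝟙-∧-false (i ≤ᵇ suc A)) (sym (if-same _ 0))

𝟙-descent : ∀ k i m A b → 𝟙 (((i ≤ᵇ suc A) ∧ not (i <ᵇ b)) ∧ ((A ≡ᵇ k) ∧ (b ≡ᵇ m)))
  ≡ (if (m ≤ᵇ i) ∧ (i ≤ᵇ suc k) then 𝟙 ((A ≡ᵇ k) ∧ (b ≡ᵇ m)) else 0)
𝟙-descent k i m A b with A ≟ k | b ≟ m
... | yes refl | yes refl rewrite ≡ᵇ-true {A} refl | ≡ᵇ-true {b} refl with b ≤? i
...   | yes b≤i rewrite <ᵇ-false (≤⇒≯ b≤i) | ≤ᵇ-true b≤i with i ≤ᵇ suc A
...     | true  = refl
...     | false = refl
𝟙-descent k i m A b | yes refl | yes refl | no b≰i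
  rewrite <ᵇ-true (≰⇒> b≰i) | ≤ᵇ-false b≰i | ∧-zeroʳ (i ≤ᵇ suc A) = refl
𝟙-descent k i m A b | yes refl | no b≢m rewrite ≡ᵇ-true {A} refl | ≡ᵇ-false b≢m =
  trans (𝟙-∧-false _) (sym (if-same _ 0))
𝟙-descent k i m A b | no A≢k | _ rewrite ≡ᵇ-false A≢k = trans (𝟙-∧-false _) (sym (if-same _ 0))

module _ (k i m : ℕ) where

  -- hasType k i m (e ∷ʳ i) in terms of the statistics v A l b of e
  appended : Bool → ℕ → ℕ → ℕ → Bool
  appended v A l b = (v ∧ appendable A l b i)
    ∧ (((if l <ᵇ i then suc A else A) ≡ᵇ k) ∧ ((i ≡ᵇ i) ∧ ((if l <ᵇ i then b ⊔ l else b) ≡ᵇ m)))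

  hasType-∷ʳ : ∀ a r → let e = a ∷ r in
    hasType k i m (e ∷ʳ i) ≡ appended (valid e) (asc e) (lastE e) (ascentBottom e)
  hasType-∷ʳ a r rewrite valid-∷ʳ a r i | asc-∷ʳ a r i | lastE-∷ʳ (a ∷ r) i | ascentBottom-∷ʳ a r i = refl

  appended-ascent : ∀ {A l b} → b ≤ l → l < i →
    appended true A l b ≡ (i ≤ᵇ suc A) ∧ ((suc A ≡ᵇ k) ∧ (l ≡ᵇ m))
  appended-ascent {A} {l} {b} b≤l l<i rewrite <ᵇ-true l<i | ≡ᵇ-false (<⇒≢ l<i)
    | <ᵇ-false {i} {b} (<⇒≱ (≤-<-trans b≤l l<i) ∘ <⇒≤) | m≤n⇒m⊔n≡n b≤l | ≡ᵇ-true {i} refl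
    | ∧-identityʳ (i ≤ᵇ suc A) = refl

  appended-plateau : ∀ v A b → appended v A i b ≡ false
  appended-plateau v A b rewrite ≡ᵇ-true {i} refl | ∧-zeroʳ (i ≤ᵇ suc A) | ∧-zeroʳ v = refl

  appended-descent : ∀ v {A l b} → i < l →
    appended v A l b ≡ (v ∧ ((i ≤ᵇ suc A) ∧ not (i <ᵇ b))) ∧ ((A ≡ᵇ k) ∧ (b ≡ᵇ m))
  appended-descent v {A} {l} {b} i<l
    rewrite <ᵇ-false (<⇒≯ i<l) | ≡ᵇ-false (≢-sym (<⇒≢ i<l)) | ≡ᵇ-true {i} refl = refl

  descentPart : Bool → ℕ → ℕ → ℕ → ℕ
  descentPart v A l b =
    if (m ≤ᵇ i) ∧ (i ≤ᵇ suc k) then (if i <ᵇ l then 𝟙 (v ∧ ((A ≡ᵇ k) ∧ ((l ≡ᵇ l) ∧ (b ≡ᵇ m)))) else 0) else 0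

  appended-count : ∀ v A l b → (v ≡ true → b ≤ l) →
    𝟙 (appended v A l b) ≡ descentPart v A l b + ascentPart k i m v A l
  appended-count false A l b _ =
    sym (cong₂ _+_ (trans (cong (λ n → if c then n else 0) (if-same (i <ᵇ l) 0)) (if-same c 0))
                   (ascentPart-false k i m A l))
    where c = (m ≤ᵇ i) ∧ (i ≤ᵇ suc k)
  appended-count true A l b b≤l with <-cmp l i
  ... | tri< l<i _ _ rewrite <ᵇ-false (<⇒≯ l<i) | if-same ((m ≤ᵇ i) ∧ (i ≤ᵇ suc k)) 0 =
    trans (cong 𝟙 (appended-ascent (b≤l refl) l<i)) (𝟙-ascent k A l<i)
  ... | tri≈ _ refl _ = trans (cong 𝟙 (appended-plateau true A b)) (sym no-contribution)
    where
    no-contribution : descentPart true A i b + ascentPart k i m true A i ≡ 0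
    no-contribution rewrite <ᵇ-false (n≮n i) | if-same ((m ≤ᵇ i) ∧ (i ≤ᵇ suc k)) 0 = ascentPart-≤ k A ≤-refl
  ... | tri> _ _ i<l rewrite <ᵇ-true i<l | ≡ᵇ-true {l} refl | ascentPart-≤ k {i} {m} A (<⇒≤ i<l)
                           | +-identityʳ (if (m ≤ᵇ i) ∧ (i ≤ᵇ suc k) then 𝟙 ((A ≡ᵇ k) ∧ (b ≡ᵇ m)) else 0) =
    trans (cong 𝟙 (appended-descent true i<l)) (𝟙-descent k i m A b)

InvSeqShape : ℕ → List ℕ → Set
InvSeqShape n e = length e ≡ n × All (_< n) e

invSeqs-shape : ∀ n → All (InvSeqShape n) (invSeqs n)
invSeqs-shape zero    = (refl , []) ∷ []
invSeqs-shape (suc n) = concat⁺ (map⁺ (All.map extend (invSeqs-shape n)))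
  where
  extend : ∀ {e} → InvSeqShape n e → All (InvSeqShape (suc n)) (map (e ∷ʳ_) (upTo (suc n)))
  extend {e} (length≡n , bounded) = map⁺ (applyUpTo⁺₁ id (suc n) λ y<1+n →
    trans (length-∷ʳ e _) (cong suc length≡n) , ∷ʳ⁺ (All.map m<n⇒m<1+n bounded) y<1+n)

sumOver-invSeqs-suc : ∀ n f →
  sumOver (invSeqs (suc n)) f ≡ sumOver (invSeqs n) (λ e → sumBelow (suc n) (λ y → f (e ∷ʳ y)))
sumOver-invSeqs-suc n f = trans (sumOver-concatMap (λ e → map (e ∷ʳ_) (upTo (suc n))) (invSeqs n) f)
  (sumOver-cong (invSeqs-shape n) λ e _ →
    trans (sumOver-map (e ∷ʳ_) (upTo (suc n)) f) (sumOver-upTo (suc n) _))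

lastE-< : ∀ {n} e → All (_< n) e → 0 < n → lastE e < n
lastE-< []          _             0<n = 0<n
lastE-< (a ∷ [])    (a<n ∷ [])    _   = a<n
lastE-< (a ∷ b ∷ r) (_ ∷ bounded) 0<n = lastE-< (b ∷ r) bounded 0<n

ascentBottom-< : ∀ {n} e → All (_< n) e → 0 < n → ascentBottom e < n
ascentBottom-< []          _                 0<n = 0<n
ascentBottom-< (a ∷ [])    _                 0<n = 0<n
ascentBottom-< {n} (a ∷ b ∷ r) (a<n ∷ b∷r<n) 0<n = ⊔-lub (bottom (a <ᵇ b)) (ascentBottom-< (b ∷ r) b∷r<n 0<n)
  where
  bottom : ∀ c → (if c then a else 0) < n
  bottom true  = a<n
  bottom false = 0<n

asc-≤ : ∀ a r → asc (a ∷ r) ≤ length r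
asc-≤ a []      = z≤n
asc-≤ a (b ∷ r) with a <ᵇ b
... | true  = s≤s (asc-≤ b r)
... | false = m≤n⇒m≤1+n (asc-≤ b r)

descentTerm-collapse : ∀ n k i m e → lastE e < n →
  descentTerm n k i m e ≡ descentPart k i m (valid e) (asc e) (lastE e) (ascentBottom e)
descentTerm-collapse n k i m e l<n = cong (λ s → if (m ≤ᵇ i) ∧ (i ≤ᵇ suc k) then s else 0)
  (sumBelow-δ n (lastE e) l<n λ j j≢l → only-last j j≢l)
  where
  only-last : ∀ j → j ≢ lastE e → (if i <ᵇ j then 𝟙 (hasType k j m e) else 0) ≡ 0
  only-last j j≢l rewrite hasType-lastE≢ k j m e (≢-sym j≢l) = if-same (i <ᵇ j) 0

ascentTerm≡ascentPart : ∀ k i m e → ascentTerm k i m e ≡ ascentPart k i m (valid e) (asc e) (lastE e)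
ascentTerm≡ascentPart zero    i m e = refl
ascentTerm≡ascentPart (suc k) i m e =
  cong (λ c → if (m <ᵇ i) ∧ (i ≤ᵇ suc k) then 𝟙 c else 0) (counted≡valid∧ k m e)

hasType-∷ʳ-count : ∀ n k i m a r → lastE (a ∷ r) < n →
  𝟙 (hasType k i m ((a ∷ r) ∷ʳ i)) ≡ descentTerm n k i m (a ∷ r) + ascentTerm k i m (a ∷ r)
hasType-∷ʳ-count n k i m a r l<n = begin
  𝟙 (hasType k i m (e ∷ʳ i))                                   ≡⟨ cong 𝟙 (hasType-∷ʳ k i m a r) ⟩
  𝟙 (appended k i m (valid e) (asc e) (lastE e) (ascentBottom e))
    ≡⟨ appended-count k i m (valid e) _ _ _ (λ v → ascentBottom≤lastE {e} (valid⇒avoids120 {e} v)) ⟩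
  descentPart k i m (valid e) (asc e) (lastE e) (ascentBottom e) + ascentPart k i m (valid e) (asc e) (lastE e)
    ≡⟨ cong₂ _+_ (descentTerm-collapse n k i m e l<n) (ascentTerm≡ascentPart k i m e) ⟨
  descentTerm n k i m e + ascentTerm k i m e                   ∎
  where
  open ≡-Reasoning
  e : List ℕ
  e = a ∷ r

refinedCount : ℕ → ℕ → ℕ → ℕ → ℕ
refinedCount n k i m = sumOver (invSeqs n) (𝟙 ∘ hasType k i m)

count≡sumOver : ∀ n k i → count n k i ≡ sumOver (invSeqs n) (𝟙 ∘ counted k i)
count≡sumOver n k i = go (invSeqs n)
  where
  go : ∀ es → length (filter (λ e → counted k i e Data.Bool.≟ true) es) ≡ sumOver es (𝟙 ∘ counted k i)
  go []       = refl
  go (e ∷ es) with counted k i e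
  ... | true  = cong suc (go es)
  ... | false = go es

descentSum : ℕ → ℕ → ℕ → ℕ → ℕ
descentSum n k i m = if (m ≤ᵇ i) ∧ (i ≤ᵇ suc k) then sumAbove n i (λ j → refinedCount n k j m) else 0

ascentSum : ℕ → ℕ → ℕ → ℕ → ℕ
ascentSum n zero    i m = 0
ascentSum n (suc k) i m = if (m <ᵇ i) ∧ (i ≤ᵇ suc k) then count n k m else 0

sumOver-descentTerm : ∀ n k i m → sumOver (invSeqs n) (descentTerm n k i m) ≡ descentSum n k i m
sumOver-descentTerm n k i m = trans (sumOver-if (invSeqs n) ((m ≤ᵇ i) ∧ (i ≤ᵇ suc k)) _)
  (cong (λ s → if (m ≤ᵇ i) ∧ (i ≤ᵇ suc k) then s else 0)
    (trans (sumOver-sumBelow (invSeqs n) n (λ j e → if i <ᵇ j then 𝟙 (hasType k j m e) else 0))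
           (sumBelow-cong n λ j _ → sumOver-if (invSeqs n) (i <ᵇ j) (𝟙 ∘ hasType k j m))))

sumOver-ascentTerm : ∀ n k i m → sumOver (invSeqs n) (ascentTerm k i m) ≡ ascentSum n k i m
sumOver-ascentTerm n zero    i m = sumOver-const0 (invSeqs n)
sumOver-ascentTerm n (suc k) i m =
  trans (sumOver-if (invSeqs n) ((m <ᵇ i) ∧ (i ≤ᵇ suc k)) (𝟙 ∘ counted k m))
        (cong (λ c → if (m <ᵇ i) ∧ (i ≤ᵇ suc k) then c else 0) (sym (count≡sumOver n k m)))

refinedCount-suc : ∀ n k i m → i < suc (suc n) →
  refinedCount (suc (suc n)) k i m ≡ descentSum (suc n) k i m + ascentSum (suc n) k i m
refinedCount-suc n k i m i<2+n = begin
  sumOver (invSeqs (suc n′)) (𝟙 ∘ hasType k i m)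
    ≡⟨ sumOver-invSeqs-suc n′ _ ⟩
  sumOver (invSeqs n′) (λ e → sumBelow (suc n′) (λ y → 𝟙 (hasType k i m (e ∷ʳ y))))
    ≡⟨ sumOver-cong (invSeqs-shape n′) (λ e _ → sumBelow-δ (suc n′) i i<2+n (λ y → ends-elsewhere e y)) ⟩
  sumOver (invSeqs n′) (λ e → 𝟙 (hasType k i m (e ∷ʳ i)))
    ≡⟨ sumOver-cong (invSeqs-shape n′) step ⟩
  sumOver (invSeqs n′) (λ e → descentTerm n′ k i m e + ascentTerm k i m e)
    ≡⟨ sumOver-+ (invSeqs n′) (descentTerm n′ k i m) (ascentTerm k i m) ⟩
  sumOver (invSeqs n′) (descentTerm n′ k i m) + sumOver (invSeqs n′) (ascentTerm k i m)
    ≡⟨ cong₂ _+_ (sumOver-descentTerm n′ k i m) (sumOver-ascentTerm n′ k i m) ⟩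
  descentSum n′ k i m + ascentSum n′ k i m ∎
  where
  open ≡-Reasoning
  n′ : ℕ
  n′ = suc n
  ends-elsewhere : ∀ e y → y ≢ i → 𝟙 (hasType k i m (e ∷ʳ y)) ≡ 0
  ends-elsewhere e y y≢i = cong 𝟙 (hasType-lastE≢ k i m (e ∷ʳ y) (subst (_≢ i) (sym (lastE-∷ʳ e y)) y≢i))
  step : ∀ e → InvSeqShape n′ e → 𝟙 (hasType k i m (e ∷ʳ i)) ≡ descentTerm n′ k i m e + ascentTerm k i m e
  step (a ∷ r) (_ , bounded) = hasType-∷ʳ-count n′ k i m a r (lastE-< (a ∷ r) bounded z<s)

refinedCount-beyondLength : ∀ n k i m → suc n ≤ i → refinedCount (suc n) k i m ≡ 0
refinedCount-beyondLength n k i m n<i = sumOver-zero (invSeqs-shape (suc n)) λ e (_ , bounded) →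
  cong 𝟙 (hasType-lastE≢ k i m e (<⇒≢ (<-≤-trans (lastE-< e bounded z<s) n<i)))

asc-< : ∀ {n e} → InvSeqShape (suc n) e → asc e < suc n
asc-< {e = a ∷ r} (length≡ , _) = s≤s (subst (asc (a ∷ r) ≤_) (suc-injective length≡) (asc-≤ a r))

refinedCount-beyondAsc : ∀ n k i m → suc n ≤ k → refinedCount (suc n) k i m ≡ 0
refinedCount-beyondAsc n k i m n<k = sumOver-zero (invSeqs-shape (suc n)) λ e shape →
  cong 𝟙 (hasType-asc≢ k i m e (<⇒≢ (<-≤-trans (asc-< shape) n<k)))

count-beyondAsc : ∀ n k i → suc n ≤ k → count (suc n) k i ≡ 0
count-beyondAsc n k i n<k = trans (count≡sumOver (suc n) k i) (sumOver-zero (invSeqs-shape (suc n)) λ e shape →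
  cong 𝟙 (counted-asc≢ k i e (<⇒≢ (<-≤-trans (asc-< shape) n<k))))

count≡sumBelow-refinedCount : ∀ n k i → count (suc n) k i ≡ sumBelow (suc n) (refinedCount (suc n) k i)
count≡sumBelow-refinedCount n k i = begin
  count (suc n) k i
    ≡⟨ count≡sumOver (suc n) k i ⟩
  sumOver (invSeqs (suc n)) (𝟙 ∘ counted k i)
    ≡⟨ sumOver-cong (invSeqs-shape (suc n)) split ⟩
  sumOver (invSeqs (suc n)) (λ e → sumBelow (suc n) (λ m → 𝟙 (hasType k i m e)))
    ≡⟨ sumOver-sumBelow (invSeqs (suc n)) (suc n) _ ⟩
  sumBelow (suc n) (refinedCount (suc n) k i) ∎
  where
  open ≡-Reasoning
  split : ∀ e → InvSeqShape (suc n) e → 𝟙 (counted k i e) ≡ sumBelow (suc n) (λ m → 𝟙 (hasType k i m e))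
  split e (_ , bounded) = sym (trans
    (sumBelow-δ (suc n) (ascentBottom e) (ascentBottom-< e bounded z<s)
      λ m m≢b → cong 𝟙 (hasType-ascentBottom≢ k i m e (≢-sym m≢b)))
    (cong 𝟙 (hasType-ascentBottom k i e)))

-- Generating polynomials of the refined counts

refinedGF : ℕ → ℕ → ℕ → Poly
refinedGF zero    zero    zero    = one
refinedGF zero    zero    (suc m) = []
refinedGF zero    (suc i) m       = []
refinedGF (suc k) i       m       =
  if (m <ᵇ i) ∧ (i ≤ᵇ suc k) then (⟨1+x⟩^ (suc k ∸ i)) ⊗ rhs k m
  else if (m ≡ᵇ i) ∧ (m ≤ᵇ k) then minusOne (⟨1+x⟩^ (suc k ∸ m)) ⊗ rhs k m
  else []

refinedGF-ascent : ∀ {k i m} → m < i → i ≤ suc k → refinedGF (suc k) i m ≡ ((⟨1+x⟩^ (suc k ∸ i)) ⊗ rhs k m)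
refinedGF-ascent m<i i≤1+k rewrite <ᵇ-true m<i | ≤ᵇ-true i≤1+k = refl

refinedGF-diagonal : ∀ {k m} → m ≤ k → refinedGF (suc k) m m ≡ (minusOne (⟨1+x⟩^ (suc k ∸ m)) ⊗ rhs k m)
refinedGF-diagonal {m = m} m≤k rewrite <ᵇ-false (n≮n m) | ≡ᵇ-true {m} refl | ≤ᵇ-true m≤k = refl

refinedGF-below : ∀ {k i m} → i < m → refinedGF k i m ≡ []
refinedGF-below {zero}  {zero}  {suc m} _   = refl
refinedGF-below {zero}  {suc i}         _   = refl
refinedGF-below {suc k}                 i<m
  rewrite <ᵇ-false (<⇒≯ i<m) | ≡ᵇ-false (≢-sym (<⇒≢ i<m)) = refl

refinedGF-above : ∀ {k i m} → k < i → refinedGF k i m ≡ []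
refinedGF-above {zero}  {suc i}     _   = refl
refinedGF-above {suc k} {i} {m} k<i rewrite ≤ᵇ-false (<⇒≱ k<i) | ∧-zeroʳ (m <ᵇ i)
  with m ≟ i
... | yes refl rewrite ≡ᵇ-true {m} refl | ≤ᵇ-false (<⇒≱ (≤-trans (n≤1+n (suc k)) k<i)) = refl
... | no m≢i   rewrite ≡ᵇ-false m≢i = refl

refinedGF-top : ∀ k → refinedGF (suc k) (suc k) (suc k) ≡ []
refinedGF-top k rewrite <ᵇ-false (n≮n k) | ≡ᵇ-true {k} refl = refl

polySum-refinedGF-< : ∀ k i → i < suc k → polySum (refinedGF (suc k) i) (suc i) ≈ rhs (suc k) i
polySum-refinedGF-< k i (s≤s i≤k) = begin
  polySum (refinedGF (suc k) i) i ⊕ refinedGF (suc k) i i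
    ≈⟨ ⊕-cong (polySum-cong i λ m m<i → ≈-reflexive (refinedGF-ascent m<i (m≤n⇒m≤1+n i≤k)))
              (≈-reflexive (refinedGF-diagonal i≤k)) ⟩
  polySum (λ m → Yₛ ⊗ rhs k m) i ⊕ (Qₛ ⊗ (A ⊗ B))
    ≈⟨ ⊕-cong (polySum-⊗ Yₛ (rhs k) i) (≈-refl {Qₛ ⊗ (A ⊗ B)}) ⟩
  (Yₛ ⊗ polySum (rhs k) i) ⊕ (Qₛ ⊗ (A ⊗ B))
    ≈⟨ ⊕-cong (⊗-congˡ Yₛ (rhs-prefixSum k i (m≤n⇒m≤1+n i≤k))) (≈-refl {Qₛ ⊗ (A ⊗ B)}) ⟩
  (Yₛ ⊗ (A ⊗ prodFrom i (suc k ∸ i))) ⊕ (Qₛ ⊗ (A ⊗ B))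
    ≡⟨ cong (λ n → (Yₛ ⊗ (A ⊗ prodFrom i n)) ⊕ (Qₛ ⊗ (A ⊗ B))) s≡1+t ⟩
  (Yₛ ⊗ (A ⊗ (Qᵢ ⊗ B))) ⊕ (Qₛ ⊗ (A ⊗ B))
    ≈⟨ solve 5 (λ a b y qᵢ qₛ → y :* (a :* (qᵢ :* b)) :+ qₛ :* (a :* b) := a :* (b :* (y :* qᵢ :+ qₛ)))
             ≈-refl A B Yₛ Qᵢ Qₛ ⟩
  A ⊗ (B ⊗ ((Yₛ ⊗ Qᵢ) ⊕ Qₛ))
    ≈⟨ ⊗-congˡ A (⊗-congˡ B (minusOne-⟨1+x⟩^-+ i (suc k ∸ i))) ⟩
  A ⊗ (B ⊗ minusOne (⟨1+x⟩^ (i + (suc k ∸ i))))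
    ≡⟨ cong (λ n → A ⊗ (B ⊗ minusOne (⟨1+x⟩^ n))) (trans (cong (i +_) s≡1+t) (+-suc i t)) ⟩
  A ⊗ (B ⊗ minusOne (⟨1+x⟩^ (suc i + t)))
    ≈⟨ ⊗-congˡ A (prodFrom-∷ʳ (suc i) t) ⟨
  A ⊗ prodFrom (suc i) (suc t)
    ≡⟨ cong (λ n → A ⊗ prodFrom (suc i) n) s≡1+t ⟨
  rhs (suc k) i ∎
  where
  open SetoidReasoning ≈-setoid
  t : ℕ
  t = k ∸ i
  s≡1+t : suc k ∸ i ≡ suc t
  s≡1+t = +-∸-assoc 1 i≤k
  A B Yₛ Qₛ Qᵢ : Poly
  A  = ⟨1+x⟩^ (i C 2)
  B  = prodFrom (suc i) t
  Yₛ = ⟨1+x⟩^ (suc k ∸ i)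
  Qₛ = minusOne (⟨1+x⟩^ (suc k ∸ i))
  Qᵢ = minusOne (⟨1+x⟩^ i)

polySum-refinedGF-top : ∀ k → polySum (refinedGF (suc k) (suc k)) (suc (suc k)) ≈ rhs (suc k) (suc k)
polySum-refinedGF-top k = begin
  polySum (refinedGF (suc k) (suc k)) (suc k) ⊕ refinedGF (suc k) (suc k) (suc k)
    ≡⟨ cong (polySum (refinedGF (suc k) (suc k)) (suc k) ⊕_) (refinedGF-top k) ⟩
  polySum (refinedGF (suc k) (suc k)) (suc k) ⊕ []
    ≈⟨ ⊕-identityʳ _ ⟩
  polySum (refinedGF (suc k) (suc k)) (suc k)
    ≈⟨ polySum-cong (suc k) (λ m m<1+k → ≈-reflexive (refinedGF-ascent m<1+k ≤-refl)) ⟩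
  polySum (λ m → (⟨1+x⟩^ (k ∸ k)) ⊗ rhs k m) (suc k)
    ≡⟨ cong (λ n → polySum (λ m → (⟨1+x⟩^ n) ⊗ rhs k m) (suc k)) (n∸n≡0 k) ⟩
  polySum (λ m → one ⊗ rhs k m) (suc k)
    ≈⟨ polySum-⊗ one (rhs k) (suc k) ⟩
  one ⊗ polySum (rhs k) (suc k)
    ≈⟨ ⊗-identityˡ _ ⟩
  polySum (rhs k) (suc k)
    ≈⟨ rhs-prefixSum k (suc k) ≤-refl ⟩
  (⟨1+x⟩^ (suc k C 2)) ⊗ prodFrom (suc k) (k ∸ k)
    ≡⟨ cong (λ n → (⟨1+x⟩^ (suc k C 2)) ⊗ prodFrom (suc k) n) (n∸n≡0 k) ⟩
  (⟨1+x⟩^ (suc k C 2)) ⊗ one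
    ≡⟨ cong (λ n → (⟨1+x⟩^ (suc k C 2)) ⊗ prodFrom (suc (suc k)) n) (n∸n≡0 k) ⟨
  rhs (suc k) (suc k) ∎
  where open SetoidReasoning ≈-setoid

polySum-refinedGF : ∀ k i → i ≤ k → polySum (refinedGF k i) (suc i) ≈ rhs k i
polySum-refinedGF zero    zero z≤n = ≈-sym (⊗-identityˡ one)
polySum-refinedGF (suc k) i i≤1+k with m≤n⇒m<n∨m≡n i≤1+k
... | inj₁ i<1+k = polySum-refinedGF-< k i i<1+k
... | inj₂ refl  = polySum-refinedGF-top k

private
  refinedGF-split : ∀ {k i m} → m ≤ i → i < suc k →
    ((⟨1+x⟩^ (suc k ∸ i)) ⊗ rhs k m) ≈ (refinedGF (suc k) (suc i) m ⊕ (0 ∷ refinedGF (suc k) (suc i) m))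
  refinedGF-split {k} {i} {m} m≤i (s≤s i≤k) = begin
    (⟨1+x⟩^ (suc k ∸ i)) ⊗ rhs k m
      ≡⟨ cong (λ n → (⟨1+x⟩^ n) ⊗ rhs k m) (+-∸-assoc 1 i≤k) ⟩
    (⟨1+x⟩^ suc (k ∸ i)) ⊗ rhs k m
      ≈⟨ ⟨1+x⟩^-suc-⊗ (k ∸ i) (rhs k m) ⟩
    ((⟨1+x⟩^ (k ∸ i)) ⊗ rhs k m) ⊕ (0 ∷ ((⟨1+x⟩^ (k ∸ i)) ⊗ rhs k m))
      ≡⟨ cong (λ p → p ⊕ (0 ∷ p)) (refinedGF-ascent (s≤s m≤i) (s≤s i≤k)) ⟨
    refinedGF (suc k) (suc i) m ⊕ (0 ∷ refinedGF (suc k) (suc i) m) ∎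
    where open SetoidReasoning ≈-setoid

refinedGF-pascal : ∀ {k i m} → m < i → i < suc k →
  refinedGF (suc k) i m ≈ (refinedGF (suc k) (suc i) m ⊕ (0 ∷ refinedGF (suc k) (suc i) m))
refinedGF-pascal m<i i<1+k =
  ≈-trans (≈-reflexive (refinedGF-ascent m<i (<⇒≤ i<1+k))) (refinedGF-split (<⇒≤ m<i) i<1+k)

refinedGF-diagonal-pascal : ∀ {k m} → m < suc k →
  (refinedGF (suc k) m m ⊕ rhs k m) ≈ (refinedGF (suc k) (suc m) m ⊕ (0 ∷ refinedGF (suc k) (suc m) m))
refinedGF-diagonal-pascal {k} {m} m<1+k = begin
  refinedGF (suc k) m m ⊕ rhs k m
    ≡⟨ cong (_⊕ rhs k m) (refinedGF-diagonal (≤-pred m<1+k)) ⟩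
  (Q ⊗ rhs k m) ⊕ rhs k m
    ≈⟨ solve 2 (λ q r → q :* r :+ r := (q :+ con 1) :* r) ≈-refl Q (rhs k m) ⟩
  (Q ⊕ one) ⊗ rhs k m
    ≈⟨ ⊗-congʳ (rhs k m) (minusOne-⟨1+x⟩^-⊕-one (suc k ∸ m)) ⟩
  (⟨1+x⟩^ (suc k ∸ m)) ⊗ rhs k m
    ≈⟨ refinedGF-split ≤-refl m<1+k ⟩
  refinedGF (suc k) (suc m) m ⊕ (0 ∷ refinedGF (suc k) (suc m) m) ∎
  where
  open SetoidReasoning ≈-setoid
  Q : Poly
  Q = minusOne (⟨1+x⟩^ (suc k ∸ m))

refinedGF-last : ∀ {k m} → m < suc k → refinedGF (suc k) (suc k) m ≈ rhs k m
refinedGF-last {k} {m} m<1+k = begin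
  refinedGF (suc k) (suc k) m     ≡⟨ refinedGF-ascent m<1+k ≤-refl ⟩
  (⟨1+x⟩^ (k ∸ k)) ⊗ rhs k m      ≡⟨ cong (λ n → (⟨1+x⟩^ n) ⊗ rhs k m) (n∸n≡0 k) ⟩
  one ⊗ rhs k m                   ≈⟨ ⊗-identityˡ (rhs k m) ⟩
  rhs k m                         ∎
  where open SetoidReasoning ≈-setoid

-- Solving the recurrence

CountFormula : ℕ → Set
CountFormula k = ∀ d i → i ≤ k → count (suc k + d) k i ≡ coeff (rhs k i) d

RefinedFormula : ℕ → Set
RefinedFormula k = ∀ d i m → refinedCount (suc k + d) k i m ≡ coeff (refinedGF k i m) d

refinedFormula⇒countFormula : ∀ k → RefinedFormula k → CountFormula k
refinedFormula⇒countFormula k refined d i i≤k = begin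
  count n k i                                    ≡⟨ count≡sumBelow-refinedCount (k + d) k i ⟩
  sumBelow n (refinedCount n k i)                ≡⟨ sumBelow-cong n (λ m _ → refined d i m) ⟩
  sumBelow n (λ m → coeff (refinedGF k i m) d)   ≡⟨ coeff-polySum (refinedGF k i) n d ⟨
  coeff (polySum (refinedGF k i) n) d            ≡⟨ coeff-≈ (polySum-vanishing (refinedGF k i) bottom≤i i<n) d ⟩
  coeff (polySum (refinedGF k i) (suc i)) d      ≡⟨ coeff-≈ (polySum-refinedGF k i i≤k) d ⟩
  coeff (rhs k i) d                              ∎
  where
  open ≡-Reasoning
  n : ℕ
  n = suc k + d
  bottom≤i : ∀ m → i < m → refinedGF k i m ≈ []
  bottom≤i m i<m = ≈-reflexive (refinedGF-below {k} i<m)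
  i<n : suc i ≤ n
  i<n = s≤s (≤-trans i≤k (m≤m+n k d))

coeff-refinedGF-zero : ∀ i m d → coeff (refinedGF 0 i m) (suc d) ≡ 0
coeff-refinedGF-zero zero    zero    d = refl
coeff-refinedGF-zero zero    (suc m) d = refl
coeff-refinedGF-zero (suc i) m       d = refl

refinedFormula-zero : RefinedFormula 0
refinedFormula-zero zero    zero    zero    = refl
refinedFormula-zero zero    zero    (suc m) = refl
refinedFormula-zero zero    (suc i) m       = refl
refinedFormula-zero (suc d) i m with i <? suc (suc d)
... | no i≮2+d = trans (refinedCount-beyondLength (suc d) 0 i m (≮⇒≥ i≮2+d)) (sym (coeff-refinedGF-zero i m d))
... | yes i<2+d = begin
  refinedCount (suc (suc d)) 0 i m
    ≡⟨ refinedCount-suc d 0 i m i<2+d ⟩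
  descentSum (suc d) 0 i m + 0
    ≡⟨ +-identityʳ _ ⟩
  descentSum (suc d) 0 i m
    ≡⟨ cong (λ s → if (m ≤ᵇ i) ∧ (i ≤ᵇ 1) then s else 0) (sumAbove-zero (suc d) i _ no-later) ⟩
  (if (m ≤ᵇ i) ∧ (i ≤ᵇ 1) then 0 else 0)
    ≡⟨ if-same _ 0 ⟩
  0
    ≡⟨ coeff-refinedGF-zero i m d ⟨
  coeff (refinedGF 0 i m) (suc d) ∎
  where
  open ≡-Reasoning
  no-later : ∀ j → i < j → refinedCount (suc d) 0 j m ≡ 0
  no-later (suc j) _ = refinedFormula-zero d (suc j) m

module RefinedStep (k : ℕ) (counts : CountFormula k) (d m : ℕ)
  (shorter : ∀ j → refinedCount (suc k + d) (suc k) j m ≡ coeff (0 ∷ refinedGF (suc k) j m) d) where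

  private
    K n : ℕ
    K = suc k
    n = suc (k + d)

    W : ℕ → ℕ
    W i = refinedCount (suc n) K i m

    G : ℕ → ℕ
    G i = coeff (refinedGF K i m) d

    P : ℕ → ℕ
    P j = refinedCount n K j m

    T : ℕ → ℕ
    T i = sumAbove n i P

    K≤n : K ≤ n
    K≤n = s≤s (m≤m+n k d)

    W-recurrence : ∀ i → i ≤ n → W i ≡ descentSum n K i m + ascentSum n K i m
    W-recurrence i i≤n = refinedCount-suc (k + d) K i m (s≤s i≤n)

    T-suc : ∀ i → T i ≡ P (suc i) + T (suc i)
    T-suc i = trans (sumAbove-suc n i P) (cong (_+ T (suc i)) within-length)
      where
      within-length : (if suc i <ᵇ n then P (suc i) else 0) ≡ P (suc i)
      within-length with suc i <ᵇ n | <ᵇ-reflects-< (suc i) n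
      ... | true  | _        = refl
      ... | false | ofⁿ 1+i≮n = sym (refinedCount-beyondLength (k + d) K (suc i) m (≮⇒≥ 1+i≮n))

    T-≥K : ∀ i → K ≤ i → T i ≡ 0
    T-≥K i K≤i = sumAbove-zero n i P λ j i<j → trans (shorter j)
      (trans (cong (λ p → coeff (0 ∷ p) d) (refinedGF-above (≤-<-trans K≤i i<j))) (coeff-≈ 0∷[]≈[] d))

    F : ℕ
    F = count n k m

    W-ascending : ∀ i → m < i → i ≤ K → W i ≡ T i + F
    W-ascending i m<i i≤K rewrite W-recurrence i (≤-trans i≤K K≤n)
      | ≤ᵇ-true (<⇒≤ m<i) | ≤ᵇ-true (m≤n⇒m≤1+n i≤K) | <ᵇ-true m<i | ≤ᵇ-true i≤K = refl

    W-diagonal : m ≤ K → W m ≡ T m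
    W-diagonal m≤K rewrite W-recurrence m (≤-trans m≤K K≤n)
      | ≤ᵇ-true (≤-refl {m}) | ≤ᵇ-true (m≤n⇒m≤1+n m≤K) | <ᵇ-false (n≮n m) = +-identityʳ (T m)

    W-vanishing : ∀ i → (i ≤ n → descentSum n K i m + ascentSum n K i m ≡ 0) → W i ≡ 0
    W-vanishing i h with i ≤? n
    ... | yes i≤n = trans (W-recurrence i i≤n) (h i≤n)
    ... | no  i≰n = refinedCount-beyondLength n K i m (≰⇒> i≰n)

    W≡G-above : ∀ i → K < i → W i ≡ G i
    W≡G-above i K<i = trans (W-vanishing i λ _ → cong₂ _+_ no-descent no-ascent)
      (sym (cong (λ p → coeff p d) (refinedGF-above K<i)))
      where
      no-descent : descentSum n K i m ≡ 0
      no-descent =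
        trans (cong (λ s → if (m ≤ᵇ i) ∧ (i ≤ᵇ suc K) then s else 0) (T-≥K i (<⇒≤ K<i))) (if-same _ 0)
      no-ascent : ascentSum n K i m ≡ 0
      no-ascent rewrite ≤ᵇ-false (<⇒≱ K<i) | ∧-zeroʳ (m <ᵇ i) = refl

    W≡G-below : ∀ i → i < m → W i ≡ G i
    W≡G-below i i<m = trans (W-vanishing i λ _ → none)
      (sym (cong (λ p → coeff p d) (refinedGF-below {K} i<m)))
      where
      none : descentSum n K i m + ascentSum n K i m ≡ 0
      none rewrite ≤ᵇ-false (<⇒≱ i<m) | <ᵇ-false (<⇒≯ i<m) = refl

    G-pascal : ∀ i → m < i → i < K → G i ≡ G (suc i) + P (suc i)
    G-pascal i m<i i<K = begin
      G i                                                        ≡⟨ coeff-≈ (refinedGF-pascal m<i i<K) d ⟩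
      coeff (refinedGF K (suc i) m ⊕ (0 ∷ refinedGF K (suc i) m)) d ≡⟨ coeff-⊕ (refinedGF K (suc i) m) _ d ⟩
      G (suc i) + coeff (0 ∷ refinedGF K (suc i) m) d             ≡⟨ cong (G (suc i) +_) (shorter (suc i)) ⟨
      G (suc i) + P (suc i)                                      ∎
      where open ≡-Reasoning

    G-diagonal : m < K → G m + F ≡ G (suc m) + P (suc m)
    G-diagonal m<K = begin
      G m + F                                                    ≡⟨ cong (G m +_) (counts d m (≤-pred m<K)) ⟩
      G m + coeff (rhs k m) d                                    ≡⟨ coeff-⊕ (refinedGF K m m) (rhs k m) d ⟨
      coeff (refinedGF K m m ⊕ rhs k m) d                        ≡⟨ coeff-≈ (refinedGF-diagonal-pascal m<K) d ⟩
      coeff (refinedGF K (suc m) m ⊕ (0 ∷ refinedGF K (suc m) m)) d ≡⟨ coeff-⊕ (refinedGF K (suc m) m) _ d ⟩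
      G (suc m) + coeff (0 ∷ refinedGF K (suc m) m) d             ≡⟨ cong (G (suc m) +_) (shorter (suc m)) ⟨
      G (suc m) + P (suc m)                                      ∎
      where open ≡-Reasoning

    W≡G-top : m < K → W K ≡ G K
    W≡G-top m<K = begin
      W K                        ≡⟨ W-ascending K m<K ≤-refl ⟩
      T K + F                    ≡⟨ cong (_+ F) (T-≥K K ≤-refl) ⟩
      F                          ≡⟨ counts d m (≤-pred m<K) ⟩
      coeff (rhs k m) d          ≡⟨ coeff-≈ (refinedGF-last m<K) d ⟨
      G K                        ∎
      where open ≡-Reasoning

    W≡G-ascending : m < K → ∀ i → m < i → i ≤ K → W i ≡ G i
    W≡G-ascending m<K = ≡-downward (W≡G-top m<K) λ i m<i i<K W≡G[1+i] → begin
      W i                        ≡⟨ W-ascending i m<i (<⇒≤ i<K) ⟩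
      T i + F                    ≡⟨ cong (_+ F) (T-suc i) ⟩
      P (suc i) + T (suc i) + F  ≡⟨ +-assoc (P (suc i)) _ _ ⟩
      P (suc i) + (T (suc i) + F) ≡⟨ cong (P (suc i) +_) (W-ascending (suc i) (m<n⇒m<1+n m<i) i<K) ⟨
      P (suc i) + W (suc i)      ≡⟨ cong (P (suc i) +_) W≡G[1+i] ⟩
      P (suc i) + G (suc i)      ≡⟨ +-comm (P (suc i)) _ ⟩
      G (suc i) + P (suc i)      ≡⟨ G-pascal i m<i i<K ⟨
      G i                        ∎
      where open ≡-Reasoning

    W≡G-diagonal : m < K → W m ≡ G m
    W≡G-diagonal m<K = +-cancelʳ-≡ F (W m) (G m) (begin
      W m + F                    ≡⟨ cong (_+ F) (W-diagonal (<⇒≤ m<K)) ⟩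
      T m + F                    ≡⟨ cong (_+ F) (T-suc m) ⟩
      P (suc m) + T (suc m) + F  ≡⟨ +-assoc (P (suc m)) _ _ ⟩
      P (suc m) + (T (suc m) + F) ≡⟨ cong (P (suc m) +_) (W-ascending (suc m) ≤-refl m<K) ⟨
      P (suc m) + W (suc m)      ≡⟨ cong (P (suc m) +_) (W≡G-ascending m<K (suc m) ≤-refl m<K) ⟩
      P (suc m) + G (suc m)      ≡⟨ +-comm (P (suc m)) _ ⟩
      G (suc m) + P (suc m)      ≡⟨ G-diagonal m<K ⟨
      G m + F                    ∎)
      where open ≡-Reasoning

    W≡G-top-diagonal : m ≡ K → W m ≡ G m
    W≡G-top-diagonal m≡K = begin
      W m                                ≡⟨ W-diagonal (≤-reflexive m≡K) ⟩
      T m                                ≡⟨ T-≥K m (≤-reflexive (sym m≡K)) ⟩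
      0                                  ≡⟨ cong (λ p → coeff p d) (refinedGF-top k) ⟨
      coeff (refinedGF K K K) d          ≡⟨ cong (λ y → coeff (refinedGF K y y) d) m≡K ⟨
      G m                                ∎
      where open ≡-Reasoning

  refinedCount≡coeff : ∀ i → refinedCount (suc (suc k) + d) (suc k) i m ≡ coeff (refinedGF (suc k) i m) d
  refinedCount≡coeff i with <-cmp i m | <-cmp i K
  ... | tri< i<m _ _ | _             = W≡G-below i i<m
  ... | tri≈ _ refl _ | tri< i<K _ _ = W≡G-diagonal i<K
  ... | tri≈ _ refl _ | tri≈ _ i≡K _ = W≡G-top-diagonal i≡K
  ... | tri> _ _ m<i | tri< i<K _ _  = W≡G-ascending (<-trans m<i i<K) i m<i (<⇒≤ i<K)
  ... | tri> _ _ m<i | tri≈ _ refl _ = W≡G-top m<i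
  ... | _            | tri> _ _ K<i  = W≡G-above i K<i

refinedFormula-suc : ∀ k → CountFormula k → RefinedFormula (suc k)
refinedFormula-suc k counts d i m = go d i
  where
  go : ∀ d i → refinedCount (suc (suc k) + d) (suc k) i m ≡ coeff (refinedGF (suc k) i m) d
  go zero    = RefinedStep.refinedCount≡coeff k counts 0 m λ j →
    refinedCount-beyondAsc (k + 0) (suc k) j m (s≤s (≤-reflexive (+-identityʳ k)))
  go (suc d) = RefinedStep.refinedCount≡coeff k counts (suc d) m λ j →
    trans (cong (λ n → refinedCount (suc n) (suc k) j m) (+-suc k d)) (go d j)

refinedFormula : ∀ k → RefinedFormula k
refinedFormula zero    = refinedFormula-zero
refinedFormula (suc k) = refinedFormula-suc k (refinedFormula⇒countFormula k (refinedFormula k))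

theorem2p3 : (k i : ℕ) → i ≤ k →
    ((n : ℕ) → 1 ≤ n → n ≤ k → count n k i ≡ 0)
    × ((d : ℕ) → count (suc k + d) k i ≡ coeff (rhs k i) d)
theorem2p3 k i i≤k = too-short , λ d → refinedFormula⇒countFormula k (refinedFormula k) d i i≤k
  where
  too-short : (n : ℕ) → 1 ≤ n → n ≤ k → count n k i ≡ 0
  too-short (suc n) _ n<k = count-beyondAsc n k i n<k
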